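{- Let $s,l,a,b,m$ be integers such that $s\geq l$ and $s\geq a\geq 0$, and let $\beta^{q}_m$ be the $q$-analogue defined in the context. Then: (i) If $b>0$, then $\beta^{q}_{m}(s,l,a,b)=\beta^{q}_{m}(s+1,l,a,b)-q^{s-a-b-m+1}\beta^{q}_{m}(s+1,l,a+1,b-1)$. (ii) If $a>0$ and $b\geq 0$, then $\beta^{q}_{m}(s,l,a-1,b)=\beta^{q}_{m}(s+1,l,a,b)-q^{a-m}\beta^{q}_{m-1}(s+1,l,a-1,b+1)$. (iii) If $b\leq 0$, then $\beta^{q}_{m}(s,l,a,b)=\beta^{q}_{m}(s+1,l,a,b)-q^{s-a-m+1}\beta^{q}_{m-1}(s+1,l,a+1,b-1)$. (iv) If $a>0$ and $b<0$, then $\beta^{q}_{m}(s,l,a-1,b)=\beta^{q}_{m}(s+1,l,a,b)-q^{a+b-m}\beta^{q}_{m}(s+1,l,a-1,b+1)$.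
   Context: Let $q$ be an indeterminate. For $n\geq 0$ set $[n]_q!=\prod_{k=1}^{n}(1+q+\cdots+q^{k-1})$. For integers $r_1,\dots,r_k$ with $r_1+\cdots+r_k\geq 0$, the $q$-multinomial coefficient is $\left[\begin{smallmatrix}r_1+\cdots+r_k\\ r_1,\dots,r_k\end{smallmatrix}\right]_q=\frac{[r_1+\cdots+r_k]_q!}{[r_1]_q!\cdots[r_k]_q!}$ if all $r_i\geq 0$ and $0$ otherwise, and for $n\geq 0$ the $q$-binomial coefficient is $\left[\begin{smallmatrix}n\\ r\end{smallmatrix}\right]_q=\left[\begin{smallmatrix}n\\ r,\,n-r\end{smallmatrix}\right]_q$. For an integer $b$ put $b_{\pm}=\frac{|b|\pm b}{2}$. For integers $a,b,s,l,m$ with $s\geq a\geq 0$ and $s\geq l$ define $$\beta^{q}_{m}(s,l,a,b)=\sum_{n=0}^{|b|+m}q^{n(n-|b|+l-2m)}\begin{bmatrix}s-a\\ b_{+}+m-n\end{bmatrix}_q\begin{bmatrix}a\\ b_{ - }+m-n\end{bmatrix}_q\begin{bmatrix}s-l+n\\ n\end{bmatrix}_q,$$ where an empty sum is $0$. -}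

module Defs where

open import Level using (Level)
open import Data.Nat as ℕ using (ℕ; zero; suc; _≤?_)
open import Data.Integer as ℤ using (ℤ; +_; -[1+_]; ∣_∣)
open import Data.List using (List; []; _∷_; length; reverse; replicate; foldr; map; upTo)
open import Data.Maybe using (Maybe; just; nothing)
open import Relation.Nullary using (yes; no)
open import Algebra.Bundles using (CommutativeRing)

-- Integer polynomials ℤ[q], coefficient lists, lowest degree first.

Poly : Set
Poly = List ℤ

infixl 6 _⊕_
infixl 7 _⊛_ _·ₚ_

_⊕_ : Poly → Poly → Poly
[]       ⊕ ys       = ys
(x ∷ xs) ⊕ []       = x ∷ xs
(x ∷ xs) ⊕ (y ∷ ys) = (x ℤ.+ y) ∷ (xs ⊕ ys)

_·ₚ_ : ℤ → Poly → Poly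
c ·ₚ xs = map (c ℤ.*_) xs

_⊛_ : Poly → Poly → Poly
[]       ⊛ ys = []
(x ∷ xs) ⊛ ys = (x ·ₚ ys) ⊕ (+ 0 ∷ (xs ⊛ ys))

one : Poly
one = + 1 ∷ []

qint : ℕ → Poly
qint k = replicate k (+ 1)

qfact : ℕ → Poly
qfact zero    = one
qfact (suc n) = qfact n ⊛ qint (suc n)

-- Exact division by a monic polynomial (long division, quotient only).
-- Lists here are highest degree first; the divisor is given by its tail
-- (its leading coefficient is 1).

subScaled : ℤ → List ℤ → List ℤ → List ℤ
subScaled c []       ns       = ns
subScaled c (d ∷ ds) []       = []
subScaled c (d ∷ ds) (x ∷ ns) = (x ℤ.- c ℤ.* d) ∷ subScaled c ds ns

divH : ℕ → List ℤ → List ℤ → List ℤ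
divH zero    _        _  = []
divH (suc f) []       _  = []
divH (suc f) (c ∷ ns) ds with length ds ≤? length ns
... | yes _ = c ∷ divH f (subScaled c ds ns) ds
... | no  _ = []

dropZeros : List ℤ → List ℤ
dropZeros []            = []
dropZeros (+ zero ∷ xs) = dropZeros xs
dropZeros (x ∷ xs)      = x ∷ xs

-- quotient of N by a monic D (both lowest degree first); used only when
-- D is monic and divides N, in which case it is the exact quotient N / D.
divMonic : Poly → Poly → Poly
divMonic N D with dropZeros (reverse N) | dropZeros (reverse D)
... | nh | []       = []
... | nh | (_ ∷ dt) = reverse (divH (length nh) nh dt)

allNonneg : List ℤ → Maybe (List ℕ)
allNonneg []              = just []
allNonneg (+ n ∷ rs)      with allNonneg rs
... | just ns = just (n ∷ ns)
... | nothing = nothing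
allNonneg (-[1+ _ ] ∷ rs) = nothing

sumℕ : List ℕ → ℕ
sumℕ = foldr ℕ._+_ 0

-- [r₁+⋯+r_k ; r₁,…,r_k]_q = [r₁+⋯+r_k]_q! / ([r₁]_q! ⋯ [r_k]_q!) if all rᵢ ≥ 0, else 0
qmultinom : List ℤ → Poly
qmultinom rs with allNonneg rs
... | just ns = divMonic (qfact (sumℕ ns)) (foldr (λ n p → qfact n ⊛ p) one ns)
... | nothing = []

qbinom : ℤ → ℤ → Poly
qbinom n r = qmultinom (r ∷ (n ℤ.- r) ∷ [])

-- b₊ = (|b|+b)/2 and b₋ = (|b|-b)/2

_₊ : ℤ → ℤ
(+ n)    ₊ = + n
-[1+ n ] ₊ = + 0

_₋ : ℤ → ℤ
(+ n)    ₋ = + 0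
-[1+ n ] ₋ = + suc n

-- Evaluation in a commutative ring R at an invertible element q
-- (with chosen inverse q⁻¹), i.e. the image under ℤ[q,q⁻¹] → R.

module Eval {c ℓ : Level} (R : CommutativeRing c ℓ) (q q⁻¹ : CommutativeRing.Carrier R) where
  open CommutativeRing R

  infixl 6 _-ᴿ_
  _-ᴿ_ : Carrier → Carrier → Carrier
  x -ᴿ y = x + (- y)

  natR : ℕ → Carrier
  natR zero    = 0#
  natR (suc n) = 1# + natR n

  intR : ℤ → Carrier
  intR (+ n)    = natR n
  intR -[1+ n ] = - natR (suc n)

  powN : Carrier → ℕ → Carrier
  powN x zero    = 1#
  powN x (suc n) = x * powN x n

  qpow : ℤ → Carrier
  qpow (+ n)    = powN q n
  qpow -[1+ n ] = powN q⁻¹ (suc n)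

  ev : Poly → Carrier
  ev []       = 0#
  ev (x ∷ xs) = intR x + q * ev xs

  sumR : List Carrier → Carrier
  sumR = foldr _+_ 0#

  β : (m s l a b : ℤ) → Carrier
  β m s l a b with (+ ∣ b ∣) ℤ.+ m
  ... | -[1+ _ ] = 0#
  ... | + k      = sumR (map term (upTo (suc k)))
    where
    term : ℕ → Carrier
    term n' =
      let n = + n' in
      qpow (n ℤ.* (((n ℤ.- (+ ∣ b ∣)) ℤ.+ l) ℤ.- ((+ 2) ℤ.* m)))
        * ev (qbinom (s ℤ.- a) ((b ₊) ℤ.+ m ℤ.- n))
        * ev (qbinom a ((b ₋) ℤ.+ m ℤ.- n))
        * ev (qbinom (s ℤ.- l ℤ.+ n) n)

  infix 4 _≈ᴿ_
  _≈ᴿ_ : Carrier → Carrier → Set ℓ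
  _≈ᴿ_ = _≈_

  infixl 7 _*ᴿ_
  _*ᴿ_ : Carrier → Carrier → Carrier
  _*ᴿ_ = _*_

module Submission where

-- With P = b₊ + m and Q = b₋ + m the defining sum of β^q_m(s,l,a,b) is
--   B(s,a;P,Q) = Σ_n q^{n(n+l-P-Q)} [s-a ; P-n] [a ; Q-n] [s-l+n ; n].
-- The recurrence  B(s,a;P,Q) + q^{s-a-P+1} B(s+1,a+1;P-1,Q) = B(s+1,a;P,Q)
-- is a summation by parts: the q-Pascal rule for [s-l+n ; n] in s telescopes
-- the sum, and the q-Pascal rules for [s+1-a ; P-n] and [a+1 ; Q-n] match the
-- remaining terms, the powers of q agreeing by an identity of exponents.
-- Through the symmetry B(s,a;P,Q) = B(s,s-a;Q,P) it becomes the second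
-- recurrence  B(s,a-1;P,Q) + q^{a-Q} B(s+1,a-1;P,Q-1) = B(s+1,a;P,Q).
-- Statements (i) and (iii) are the first recurrence, (ii) and (iv) the
-- second, after computing b₊ and b₋ of the shifted b.

open import Defs
open import Level using (Level)
open import Data.Nat as ℕ using (ℕ; zero; suc; z≤n; s≤s)
import Data.Nat.Properties as ℕP
open import Data.Integer as ℤ using (ℤ; +_; -[1+_]; ∣_∣)
import Data.Integer.Properties as ℤP
import Data.Integer.Tactic.RingSolver as ℤSolver
open import Data.List using (List; []; _∷_; _++_; length; reverse; replicate; map; foldr; applyUpTo)
import Data.List.Properties as ListP
open import Data.Product using (Σ; _×_; _,_)
open import Data.Empty using (⊥-elim)
open import Data.Maybe using (nothing)
open import Relation.Nullary using (yes; no)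
open import Relation.Binary.Definitions using (tri<; tri≈; tri>)
open import Relation.Binary.PropositionalEquality as ≡ using (_≡_)
open import Algebra.Bundles using (CommutativeRing; CommutativeSemiring)
import Algebra.Solver.Ring.NaturalCoefficients as NaturalSolver

-- Coefficient lists up to coefficientwise equality form a commutative
-- semiring; this lets the ring solver reason about polynomial identities.

module CoefficientLists where
  open ≡ using (refl; sym; trans; cong; cong₂)
  open import Data.Integer using (_+_; _*_)

  coeff : Poly → ℕ → ℤ
  coeff []       _       = + 0
  coeff (x ∷ xs) zero    = x
  coeff (x ∷ xs) (suc i) = coeff xs i

  -- Equality as polynomials: trailing zeros are invisible.
  infix 4 _≋_
  record _≋_ (xs ys : Poly) : Set where
    constructor mk≋
    field at : ∀ i → coeff xs i ≡ coeff ys i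
  open _≋_ public

  ≋-refl : ∀ {xs} → xs ≋ xs
  ≋-refl = mk≋ λ i → refl

  ≋-sym : ∀ {xs ys} → xs ≋ ys → ys ≋ xs
  ≋-sym p = mk≋ λ i → sym (at p i)

  ≋-trans : ∀ {xs ys zs} → xs ≋ ys → ys ≋ zs → xs ≋ zs
  ≋-trans p p' = mk≋ λ i → trans (at p i) (at p' i)

  ≋-reflexive : ∀ {xs ys} → xs ≡ ys → xs ≋ ys
  ≋-reflexive refl = ≋-refl

  ∷-cong : ∀ {x y xs ys} → x ≡ y → xs ≋ ys → (x ∷ xs) ≋ (y ∷ ys)
  ∷-cong e p = mk≋ λ { zero → e ; (suc i) → at p i }

  ∷-injectiveʳ : ∀ {x y xs ys} → (x ∷ xs) ≋ (y ∷ ys) → xs ≋ ys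
  ∷-injectiveʳ p = mk≋ λ i → at p (suc i)

  shift : Poly → Poly
  shift p = + 0 ∷ p

  shift-cong : ∀ {p p'} → p ≋ p' → shift p ≋ shift p'
  shift-cong = ∷-cong refl

  coeff-⊕ : ∀ xs ys i → coeff (xs ⊕ ys) i ≡ coeff xs i + coeff ys i
  coeff-⊕ []       ys       i       = sym (ℤP.+-identityˡ _)
  coeff-⊕ (x ∷ xs) []       i       = sym (ℤP.+-identityʳ _)
  coeff-⊕ (x ∷ xs) (y ∷ ys) zero    = refl
  coeff-⊕ (x ∷ xs) (y ∷ ys) (suc i) = coeff-⊕ xs ys i

  coeff-· : ∀ c xs i → coeff (c ·ₚ xs) i ≡ c * coeff xs i
  coeff-· c []       i       = sym (ℤP.*-zeroʳ c)
  coeff-· c (x ∷ xs) zero    = refl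
  coeff-· c (x ∷ xs) (suc i) = coeff-· c xs i

  coeff-⊛-∷ : ∀ x xs ys i → coeff ((x ∷ xs) ⊛ ys) i ≡ x * coeff ys i + coeff (shift (xs ⊛ ys)) i
  coeff-⊛-∷ x xs ys i = trans (coeff-⊕ (x ·ₚ ys) _ i) (cong (_+ coeff (shift (xs ⊛ ys)) i) (coeff-· x ys i))

  ⊕-cong : ∀ {a a' b b'} → a ≋ a' → b ≋ b' → (a ⊕ b) ≋ (a' ⊕ b')
  ⊕-cong {a} {a'} {b} {b'} p p' = mk≋ λ i →
    trans (coeff-⊕ a b i) (trans (cong₂ _+_ (at p i) (at p' i)) (sym (coeff-⊕ a' b' i)))

  ⊕-comm : ∀ a b → (a ⊕ b) ≋ (b ⊕ a)
  ⊕-comm a b = mk≋ λ i →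
    trans (coeff-⊕ a b i) (trans (ℤP.+-comm (coeff a i) (coeff b i)) (sym (coeff-⊕ b a i)))

  ⊕-assoc : ∀ a b c → ((a ⊕ b) ⊕ c) ≋ (a ⊕ (b ⊕ c))
  ⊕-assoc a b c = mk≋ λ i →
    trans (coeff-⊕ (a ⊕ b) c i) (trans (cong (_+ coeff c i) (coeff-⊕ a b i))
    (trans (ℤP.+-assoc (coeff a i) (coeff b i) (coeff c i))
    (trans (cong (λ u → coeff a i + u) (sym (coeff-⊕ b c i))) (sym (coeff-⊕ a (b ⊕ c) i)))))

  ⊕-identityʳ : ∀ a → (a ⊕ []) ≋ a
  ⊕-identityʳ []      = ≋-refl
  ⊕-identityʳ (x ∷ a) = ≋-refl

  ·-distrib-⊕ : ∀ k a b → (k ·ₚ (a ⊕ b)) ≋ ((k ·ₚ a) ⊕ (k ·ₚ b))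
  ·-distrib-⊕ k a b = mk≋ λ i →
    trans (coeff-· k (a ⊕ b) i) (trans (cong (λ u → k * u) (coeff-⊕ a b i))
    (trans (ℤP.*-distribˡ-+ k (coeff a i) (coeff b i))
    (sym (trans (coeff-⊕ (k ·ₚ a) (k ·ₚ b) i) (cong₂ _+_ (coeff-· k a i) (coeff-· k b i))))))

  ·-assoc : ∀ j k a → (j ·ₚ (k ·ₚ a)) ≋ ((j * k) ·ₚ a)
  ·-assoc j k a = mk≋ λ i →
    trans (coeff-· j (k ·ₚ a) i) (trans (cong (λ u → j * u) (coeff-· k a i))
    (trans (sym (ℤP.*-assoc j k (coeff a i))) (sym (coeff-· (j * k) a i))))

  ·-shift : ∀ k p → (k ·ₚ shift p) ≋ shift (k ·ₚ p)
  ·-shift k p = ∷-cong (ℤP.*-zeroʳ k) ≋-refl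

  zero-⊛ : ∀ xs ys → [] ≋ xs → (xs ⊛ ys) ≋ []
  zero-⊛ []       ys p = ≋-refl
  zero-⊛ (x ∷ xs) ys p = mk≋ λ i → trans (coeff-⊛-∷ x xs ys i) (vanish i)
    where
    x≡0 : x ≡ + 0
    x≡0 = sym (at p zero)
    rest : (xs ⊛ ys) ≋ []
    rest = zero-⊛ xs ys (mk≋ λ i → at p (suc i))
    vanish : ∀ i → x * coeff ys i + coeff (shift (xs ⊛ ys)) i ≡ + 0
    vanish zero    rewrite x≡0 = refl
    vanish (suc i) rewrite x≡0 | at rest i = refl

  ⊛-congˡ : ∀ {a b} c → a ≋ b → (a ⊛ c) ≋ (b ⊛ c)
  ⊛-congˡ {[]}    {b}     c p = ≋-sym (zero-⊛ b c p)
  ⊛-congˡ {x ∷ a} {[]}    c p = zero-⊛ (x ∷ a) c (≋-sym p)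
  ⊛-congˡ {x ∷ a} {y ∷ b} c p = mk≋ λ i →
    trans (coeff-⊛-∷ x a c i)
    (trans (cong₂ (λ u v → u * coeff c i + v) (at p zero) (at (shift-cong (⊛-congˡ c (∷-injectiveʳ p))) i))
    (sym (coeff-⊛-∷ y b c i)))

  ⊛-congʳ : ∀ a {b c} → b ≋ c → (a ⊛ b) ≋ (a ⊛ c)
  ⊛-congʳ []      p = ≋-refl
  ⊛-congʳ (x ∷ a) {b} {c} p = mk≋ λ i →
    trans (coeff-⊛-∷ x a b i)
    (trans (cong₂ (λ u v → x * u + v) (at p i) (at (shift-cong (⊛-congʳ a p)) i))
    (sym (coeff-⊛-∷ x a c i)))

  ⊛-cong : ∀ {a b c d} → a ≋ b → c ≋ d → (a ⊛ c) ≋ (b ⊛ d)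
  ⊛-cong {a} {b} {c} p p' = ≋-trans (⊛-congˡ c p) (⊛-congʳ b p')

  ⊛-distribʳ : ∀ a b c → ((a ⊕ b) ⊛ c) ≋ ((a ⊛ c) ⊕ (b ⊛ c))
  ⊛-distribʳ []      b       c = ≋-refl
  ⊛-distribʳ (x ∷ a) []      c = ≋-sym (⊕-identityʳ _)
  ⊛-distribʳ (x ∷ a) (y ∷ b) c = mk≋ λ i →
    trans (coeff-⊛-∷ (x + y) (a ⊕ b) c i)
    (trans (cong (λ u → (x + y) * coeff c i + u)
             (trans (at (shift-cong (⊛-distribʳ a b c)) i) (coeff-⊕ (shift (a ⊛ c)) (shift (b ⊛ c)) i)))
    (trans (regroup x y (coeff c i) _ _)
    (sym (trans (coeff-⊕ ((x ∷ a) ⊛ c) ((y ∷ b) ⊛ c) i)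
               (cong₂ _+_ (coeff-⊛-∷ x a c i) (coeff-⊛-∷ y b c i))))))
    where
    regroup : ∀ x y u v w → (x + y) * u + (v + w) ≡ (x * u + v) + (y * u + w)
    regroup = ℤSolver.solve-∀

  ·-⊛ : ∀ k a b → ((k ·ₚ a) ⊛ b) ≋ (k ·ₚ (a ⊛ b))
  ·-⊛ k []      b = ≋-refl
  ·-⊛ k (x ∷ a) b =
    ≋-trans (⊕-cong (≋-sym (·-assoc k x b)) (shift-cong (·-⊛ k a b)))
    (≋-trans (⊕-cong ≋-refl (≋-sym (·-shift k (a ⊛ b)))) (≋-sym (·-distrib-⊕ k (x ·ₚ b) (shift (a ⊛ b)))))

  ⊕-interchange : ∀ a b c d → ((a ⊕ b) ⊕ (c ⊕ d)) ≋ ((a ⊕ c) ⊕ (b ⊕ d))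
  ⊕-interchange a b c d = mk≋ λ i →
    trans (coeff-⊕ (a ⊕ b) (c ⊕ d) i) (trans (cong₂ _+_ (coeff-⊕ a b i) (coeff-⊕ c d i))
    (trans (interchange (coeff a i) (coeff b i) (coeff c i) (coeff d i))
    (sym (trans (coeff-⊕ (a ⊕ c) (b ⊕ d) i) (cong₂ _+_ (coeff-⊕ a c i) (coeff-⊕ b d i))))))
    where
    interchange : ∀ w x y z → (w + x) + (y + z) ≡ (w + y) + (x + z)
    interchange = ℤSolver.solve-∀

  ⊛-distribˡ : ∀ a b c → (a ⊛ (b ⊕ c)) ≋ ((a ⊛ b) ⊕ (a ⊛ c))
  ⊛-distribˡ []      b c = ≋-refl
  ⊛-distribˡ (x ∷ a) b c =
    ≋-trans (⊕-cong (·-distrib-⊕ x b c) (shift-cong (⊛-distribˡ a b c)))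
            (⊕-interchange (x ·ₚ b) (x ·ₚ c) (shift (a ⊛ b)) (shift (a ⊛ c)))

  ⊛-shiftˡ : ∀ a b → (shift a ⊛ b) ≋ shift (a ⊛ b)
  ⊛-shiftˡ a b = mk≋ λ i → trans (coeff-⊛-∷ (+ 0) a b i) (ℤP.+-identityˡ _)

  ⊛-zeroʳ : ∀ a → (a ⊛ []) ≋ []
  ⊛-zeroʳ []      = ≋-refl
  ⊛-zeroʳ (x ∷ a) = ≋-trans (shift-cong (⊛-zeroʳ a)) (mk≋ λ { zero → refl ; (suc i) → refl })

  ⊛-∷ʳ : ∀ a x b → (a ⊛ (x ∷ b)) ≋ ((x ·ₚ a) ⊕ shift (a ⊛ b))
  ⊛-∷ʳ []      x b = mk≋ λ { zero → refl ; (suc i) → refl }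
  ⊛-∷ʳ (y ∷ a) x b = mk≋ λ
    { zero → trans (ℤP.+-identityʳ _) (trans (ℤP.*-comm y x) (sym (ℤP.+-identityʳ _)))
    ; (suc i) →
        trans (coeff-⊕ (y ·ₚ b) (a ⊛ (x ∷ b)) i)
        (trans (cong₂ _+_ (coeff-· y b i) (trans (at (⊛-∷ʳ a x b) i) (coeff-⊕ (x ·ₚ a) (shift (a ⊛ b)) i)))
        (trans (cong (λ u → y * coeff b i + (u + coeff (shift (a ⊛ b)) i)) (coeff-· x a i))
        (trans (exchange y (coeff b i) x (coeff a i) (coeff (shift (a ⊛ b)) i))
        (sym (trans (coeff-⊕ (x ·ₚ a) ((y ·ₚ b) ⊕ shift (a ⊛ b)) i)
          (cong₂ _+_ (coeff-· x a i)
            (trans (coeff-⊕ (y ·ₚ b) (shift (a ⊛ b)) i) (cong (_+ coeff (shift (a ⊛ b)) i) (coeff-· y b i)))))))))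
    }
    where
    exchange : ∀ y u x v w → y * u + (x * v + w) ≡ x * v + (y * u + w)
    exchange = ℤSolver.solve-∀

  ⊛-comm : ∀ a b → (a ⊛ b) ≋ (b ⊛ a)
  ⊛-comm []      b = ≋-sym (⊛-zeroʳ b)
  ⊛-comm (x ∷ a) b = ≋-trans (⊕-cong ≋-refl (shift-cong (⊛-comm a b))) (≋-sym (⊛-∷ʳ b x a))

  ⊛-assoc : ∀ a b c → ((a ⊛ b) ⊛ c) ≋ (a ⊛ (b ⊛ c))
  ⊛-assoc []      b c = ≋-refl
  ⊛-assoc (x ∷ a) b c =
    ≋-trans (⊛-distribʳ (x ·ₚ b) (shift (a ⊛ b)) c)
    (⊕-cong (·-⊛ x b c) (≋-trans (⊛-shiftˡ (a ⊛ b) c) (shift-cong (⊛-assoc a b c))))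

  one-⊛ : ∀ a → (one ⊛ a) ≋ a
  one-⊛ a = mk≋ λ i → trans (coeff-⊛-∷ (+ 1) [] a i) (trans (drop-tail i) (ℤP.*-identityˡ (coeff a i)))
    where
    drop-tail : ∀ i → + 1 * coeff a i + coeff (shift []) i ≡ + 1 * coeff a i
    drop-tail zero    = ℤP.+-identityʳ _
    drop-tail (suc i) = ℤP.+-identityʳ _

  ⊛-one : ∀ a → (a ⊛ one) ≋ a
  ⊛-one a = ≋-trans (⊛-comm a one) (one-⊛ a)

  polySemiring : CommutativeSemiring _ _
  polySemiring = record
    { Carrier = Poly ; _≈_ = _≋_ ; _+_ = _⊕_ ; _*_ = _⊛_ ; 0# = [] ; 1# = one
    ; isCommutativeSemiring = record
      { isSemiring = record
        { isSemiringWithoutAnnihilatingZero = record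
          { +-isCommutativeMonoid = record
            { isMonoid = record
              { isSemigroup = record
                { isMagma = record
                  { isEquivalence = record { refl = ≋-refl ; sym = ≋-sym ; trans = ≋-trans }
                  ; ∙-cong = ⊕-cong }
                ; assoc = ⊕-assoc }
              ; identity = (λ a → ≋-refl) , ⊕-identityʳ }
            ; comm = ⊕-comm }
          ; *-cong = ⊛-cong
          ; *-assoc = ⊛-assoc
          ; *-identity = one-⊛ , ⊛-one
          ; distrib = ⊛-distribˡ , (λ a b c → ⊛-distribʳ b c a) }
        ; zero = (λ a → ≋-refl) , ⊛-zeroʳ }
      ; *-comm = ⊛-comm } }

open CoefficientLists

-- Gaussian polynomials.  G r k is [r+k ; r]_q, defined by the q-Pascal
-- recursion [r+1+k+1 ; r+1] = [r+1+k ; r+1] + q^{k+1} [r+k+1 ; r].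

module GaussianPolynomials where
  open ≡ using (refl; sym; trans; cong; subst)
  open import Data.Integer using (_+_; _*_)
  open import Relation.Binary.Reasoning.Setoid (CommutativeSemiring.setoid polySemiring)
  open NaturalSolver polySemiring (λ _ _ → nothing) using (solve; _:+_; _:*_; _:=_)

  zeros : ℕ → Poly
  zeros n = replicate n (+ 0)

  length-zeros : ∀ n → length (zeros n) ≡ n
  length-zeros n = ListP.length-replicate n

  monomial : ℕ → Poly
  monomial j = zeros j ++ one

  zeros-++ : ∀ j p → (zeros j ++ p) ≋ (monomial j ⊛ p)
  zeros-++ zero    p = ≋-sym (one-⊛ p)
  zeros-++ (suc j) p = ≋-trans (shift-cong (zeros-++ j p)) (≋-sym (⊛-shiftˡ (monomial j) p))

  G : ℕ → ℕ → Poly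
  G zero    k       = one
  G (suc r) zero    = one
  G (suc r) (suc k) = G (suc r) k ⊕ (zeros (suc k) ++ G r (suc k))

  qint-split : ∀ j n → qint j ⊕ (zeros j ++ qint n) ≡ qint (j ℕ.+ n)
  qint-split zero    n = refl
  qint-split (suc j) n = cong (+ 1 ∷_) (qint-split j n)

  -- The factorial identity [r+k]! = [r+k ; r] [r]! [k]!, by induction along
  -- the q-Pascal recursion of G and the splitting [r+k+2] = [k+1] + q^{k+1}[r+1].
  factorial-split : ∀ r k → qfact (r ℕ.+ k) ≋ (G r k ⊛ (qfact r ⊛ qfact k))
  factorial-split zero    k = ≋-sym (≋-trans (one-⊛ _) (one-⊛ _))
  factorial-split (suc r) zero rewrite ℕP.+-identityʳ r = ≋-sym (≋-trans (one-⊛ _) (⊛-one _))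
  factorial-split (suc r) (suc k) = begin
    qfact n ⊛ qint (suc n)
      ≈⟨ ⊛-congʳ (qfact n) (≋-reflexive (sym split)) ⟩
    qfact n ⊛ (Ik ⊕ (zeros (suc k) ++ Ir))
      ≈⟨ ⊛-congʳ (qfact n) (⊕-cong {Ik} ≋-refl (zeros-++ (suc k) Ir)) ⟩
    qfact n ⊛ (Ik ⊕ X ⊛ Ir)
      ≈⟨ solve 4 (λ f ik x ir → f :* (ik :+ x :* ir) := f :* ik :+ x :* (f :* ir)) ≋-refl (qfact n) Ik X Ir ⟩
    qfact n ⊛ Ik ⊕ X ⊛ (qfact n ⊛ Ir)
      ≈⟨ ⊕-cong (⊛-congˡ Ik left) (⊛-congʳ X (⊛-congˡ Ir right)) ⟩
    (G (suc r) k ⊛ ((qfact r ⊛ Ir) ⊛ qfact k)) ⊛ Ik ⊕ X ⊛ ((G r (suc k) ⊛ (qfact r ⊛ (qfact k ⊛ Ik))) ⊛ Ir)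
      ≈⟨ solve 7 (λ a b x fr fk ir ik →
           (a :* ((fr :* ir) :* fk)) :* ik :+ x :* ((b :* (fr :* (fk :* ik))) :* ir)
             := (a :+ x :* b) :* ((fr :* ir) :* (fk :* ik)))
           ≋-refl (G (suc r) k) (G r (suc k)) X (qfact r) (qfact k) Ir Ik ⟩
    (G (suc r) k ⊕ X ⊛ G r (suc k)) ⊛ (qfact (suc r) ⊛ qfact (suc k))
      ≈⟨ ⊛-congˡ _ (⊕-cong {G (suc r) k} ≋-refl (≋-sym (zeros-++ (suc k) (G r (suc k))))) ⟩
    G (suc r) (suc k) ⊛ (qfact (suc r) ⊛ qfact (suc k)) ∎
    where
    n = r ℕ.+ suc k
    Ik = qint (suc k)
    Ir = qint (suc r)
    X = monomial (suc k)
    split : Ik ⊕ (zeros (suc k) ++ Ir) ≡ qint (suc n)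
    split = trans (qint-split (suc k) (suc r))
      (cong (λ u → qint (suc u)) (trans (ℕP.+-suc k r) (trans (cong suc (ℕP.+-comm k r)) (sym (ℕP.+-suc r k)))))
    left : qfact n ≋ (G (suc r) k ⊛ (qfact (suc r) ⊛ qfact k))
    left = subst (λ u → qfact u ≋ (G (suc r) k ⊛ (qfact (suc r) ⊛ qfact k))) (sym (ℕP.+-suc r k)) (factorial-split (suc r) k)
    right : qfact n ≋ (G r (suc k) ⊛ (qfact r ⊛ qfact (suc k)))
    right = factorial-split r (suc k)

open GaussianPolynomials

-- Long division of A ⊛ D by a monic D returns A when A is
-- monic as well; with the factorial identity this identifies the
-- q-binomial coefficient of Defs with the Gaussian polynomial G r k.

module ExactDivision where
  open ≡ using (refl; sym; trans; cong; cong₂; subst₂)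
  open import Data.Integer using (_+_; _*_; _-_)
  open import Data.Nat using (_≤_)

  length-⊕ʳ : ∀ a b → length a ≤ length b → length (a ⊕ b) ≡ length b
  length-⊕ʳ []      b       p       = refl
  length-⊕ʳ (x ∷ a) (y ∷ b) (s≤s p) = cong suc (length-⊕ʳ a b p)

  length-⊕-≤ : ∀ a b n → length a ≤ n → length b ≤ n → length (a ⊕ b) ≤ n
  length-⊕-≤ []      b       n       p       q       = q
  length-⊕-≤ (x ∷ a) []      n       p       q       = p
  length-⊕-≤ (x ∷ a) (y ∷ b) (suc n) (s≤s p) (s≤s q) = s≤s (length-⊕-≤ a b n p q)

  length-· : ∀ c a → length (c ·ₚ a) ≡ length a
  length-· c a = ListP.length-map (c *_) a

  ⊕-identityʳ≡ : ∀ a → a ⊕ [] ≡ a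
  ⊕-identityʳ≡ []      = refl
  ⊕-identityʳ≡ (x ∷ a) = refl

  length-⊛-≤ : ∀ a y b → length (a ⊛ (y ∷ b)) ≤ length a ℕ.+ length b
  length-⊛-≤ []      y b = z≤n
  length-⊛-≤ (x ∷ a) y b = length-⊕-≤ (x ·ₚ (y ∷ b)) (shift (a ⊛ (y ∷ b))) _
    (ℕP.≤-trans (ℕP.≤-reflexive (length-· x (y ∷ b))) (s≤s (ℕP.m≤n+m (length b) (length a))))
    (s≤s (length-⊛-≤ a y b))

  length-⊛ : ∀ x a y b → length ((x ∷ a) ⊛ (y ∷ b)) ≡ suc (length a ℕ.+ length b)
  length-⊛ x []       y b = cong suc (trans (cong length (⊕-identityʳ≡ (map (x *_) b))) (length-· x b))
  length-⊛ x (x' ∷ a) y b = trans (length-⊕ʳ (x ·ₚ (y ∷ b)) (shift ((x' ∷ a) ⊛ (y ∷ b))) fits) (cong suc rest)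
    where
    rest : length ((x' ∷ a) ⊛ (y ∷ b)) ≡ suc (length a ℕ.+ length b)
    rest = length-⊛ x' a y b
    fits : length (x ·ₚ (y ∷ b)) ≤ suc (length ((x' ∷ a) ⊛ (y ∷ b)))
    fits rewrite length-· x (y ∷ b) | rest = s≤s (ℕP.≤-trans (ℕP.m≤n+m (length b) (length a)) (ℕP.n≤1+n _))

  ⊕-assoc≡ : ∀ a b c → (a ⊕ b) ⊕ c ≡ a ⊕ (b ⊕ c)
  ⊕-assoc≡ []      b       c       = refl
  ⊕-assoc≡ (x ∷ a) []      c       = refl
  ⊕-assoc≡ (x ∷ a) (y ∷ b) []      = refl
  ⊕-assoc≡ (x ∷ a) (y ∷ b) (z ∷ c) = cong₂ _∷_ (ℤP.+-assoc x y z) (⊕-assoc≡ a b c)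

  ⊕-++-∷ʳ : ∀ X Y y → length X ≤ length Y → X ⊕ (Y ++ y ∷ []) ≡ (X ⊕ Y) ++ y ∷ []
  ⊕-++-∷ʳ []      Y       y p       = refl
  ⊕-++-∷ʳ (x ∷ X) (z ∷ Y) y (s≤s p) = cong (x + z ∷_) (⊕-++-∷ʳ X Y y p)

  ++-∷ʳ-⊕ : ∀ P W p w → length P ≡ length W → (P ++ p ∷ []) ⊕ (W ++ w ∷ []) ≡ (P ⊕ W) ++ (p + w) ∷ []
  ++-∷ʳ-⊕ []      []      p w e = refl
  ++-∷ʳ-⊕ (x ∷ P) (y ∷ W) p w e = cong (x + y ∷_) (++-∷ʳ-⊕ P W p w (ℕP.suc-injective e))

  ∷ʳ-⊛ : ∀ xs g d ds → (xs ++ g ∷ []) ⊛ (d ∷ ds) ≡ (xs ⊛ (d ∷ ds)) ⊕ (zeros (length xs) ++ (g ·ₚ (d ∷ ds)))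
  ∷ʳ-⊛ []       g d ds = cong₂ _∷_ (ℤP.+-identityʳ (g * d)) (⊕-identityʳ≡ (map (g *_) ds))
  ∷ʳ-⊛ (x ∷ xs) g d ds = trans (cong (λ u → (x ·ₚ (d ∷ ds)) ⊕ (+ 0 ∷ u)) (∷ʳ-⊛ xs g d ds))
    (sym (⊕-assoc≡ (x ·ₚ (d ∷ ds)) (+ 0 ∷ (xs ⊛ (d ∷ ds))) (+ 0 ∷ (zeros (length xs) ++ (g ·ₚ (d ∷ ds))))))

  one-· : ∀ a → (+ 1) ·ₚ a ≡ a
  one-· []      = refl
  one-· (x ∷ a) = cong₂ _∷_ (ℤP.*-identityˡ x) (one-· a)

  Monic : Poly → Set
  Monic p = Σ Poly λ ys → p ≡ ys ++ + 1 ∷ []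

  -- with D = B₀ + q^|B₀|:  (A₀ + q^|A₀|) D = (A₀ D + q^|A₀| B₀) + q^{|A₀|+|B₀|}
  monic-⊛-∷ : ∀ A₀ d ds B₀ → d ∷ ds ≡ B₀ ++ + 1 ∷ [] → Monic ((A₀ ++ + 1 ∷ []) ⊛ (d ∷ ds))
  monic-⊛-∷ A₀ d ds B₀ eD = (A₀ ⊛ D) ⊕ (zeros (length A₀) ++ B₀) ,
    trans (∷ʳ-⊛ A₀ (+ 1) d ds)
    (trans (cong (λ u → (A₀ ⊛ D) ⊕ (zeros (length A₀) ++ u)) (trans (one-· D) eD))
    (trans (cong ((A₀ ⊛ D) ⊕_) (sym (ListP.++-assoc (zeros (length A₀)) B₀ (+ 1 ∷ []))))
           (⊕-++-∷ʳ (A₀ ⊛ D) (zeros (length A₀) ++ B₀) (+ 1) fits)))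
    where
    D = d ∷ ds
    length-ds : length ds ≡ length B₀
    length-ds = ℕP.suc-injective (trans (cong length eD) (trans (ListP.length-++ B₀) (ℕP.+-comm (length B₀) 1)))
    fits : length (A₀ ⊛ D) ≤ length (zeros (length A₀) ++ B₀)
    fits rewrite ListP.length-++ (zeros (length A₀)) {B₀} | length-zeros (length A₀) | sym length-ds =
      length-⊛-≤ A₀ d ds

  monic-⊛ : ∀ A B → Monic A → Monic B → Monic (A ⊛ B)
  monic-⊛ _ _ (A₀ , refl) ([]     , refl) = monic-⊛-∷ A₀ (+ 1) [] [] refl
  monic-⊛ _ _ (A₀ , refl) (b ∷ B₀ , refl) = monic-⊛-∷ A₀ b (B₀ ++ + 1 ∷ []) (b ∷ B₀) refl

  monic-qint : ∀ n → Monic (qint (suc n))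
  monic-qint zero    = [] , refl
  monic-qint (suc n) with monic-qint n
  ... | (B₀ , e) = (+ 1 ∷ B₀) , cong (+ 1 ∷_) e

  monic-qfact : ∀ n → Monic (qfact n)
  monic-qfact zero    = [] , refl
  monic-qfact (suc n) = monic-⊛ (qfact n) (qint (suc n)) (monic-qfact n) (monic-qint n)

  length-G : ∀ r k → length (G r k) ≡ suc (r ℕ.* k)
  length-G zero    k       = refl
  length-G (suc r) zero    = cong suc (sym (ℕP.*-zeroʳ r))
  length-G (suc r) (suc k) =
    trans (length-⊕ʳ (G (suc r) k) (zeros (suc k) ++ G r (suc k)) fits)
    (trans (ListP.length-++ (zeros (suc k)))
    (trans (cong₂ ℕ._+_ (length-zeros (suc k)) (length-G r (suc k))) (ℕP.+-suc (suc k) (r ℕ.* suc k))))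
    where
    fits : length (G (suc r) k) ≤ length (zeros (suc k) ++ G r (suc k))
    fits = subst₂ _≤_ (sym (length-G (suc r) k))
      (sym (trans (ListP.length-++ (zeros (suc k))) (cong₂ ℕ._+_ (length-zeros (suc k)) (length-G r (suc k)))))
      (s≤s (ℕP.+-monoʳ-≤ k (ℕP.≤-trans (ℕP.*-monoʳ-≤ r (ℕP.n≤1+n k)) (ℕP.n≤1+n _))))

  monic-G : ∀ r k → Monic (G r k)
  monic-G zero    k       = [] , refl
  monic-G (suc r) zero    = [] , refl
  monic-G (suc r) (suc k) with monic-G r (suc k)
  ... | (B₀ , eB) = G (suc r) k ⊕ (zeros (suc k) ++ B₀) ,
    trans (cong (λ u → G (suc r) k ⊕ (zeros (suc k) ++ u)) eB)
    (trans (cong (G (suc r) k ⊕_) (sym (ListP.++-assoc (zeros (suc k)) B₀ (+ 1 ∷ []))))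
           (⊕-++-∷ʳ (G (suc r) k) (zeros (suc k) ++ B₀) (+ 1) fits))
    where
    length-B₀ : suc (length B₀) ≡ suc (r ℕ.* suc k)
    length-B₀ = trans (trans (ℕP.+-comm 1 (length B₀)) (sym (ListP.length-++ B₀)))
                      (trans (cong length (sym eB)) (length-G r (suc k)))
    fits : length (G (suc r) k) ≤ length (zeros (suc k) ++ B₀)
    fits = subst₂ _≤_ (sym (length-G (suc r) k))
      (sym (trans (ListP.length-++ (zeros (suc k))) (cong₂ ℕ._+_ (length-zeros (suc k)) (ℕP.suc-injective length-B₀))))
      (s≤s (ℕP.+-monoʳ-≤ k (ℕP.*-monoʳ-≤ r (ℕP.n≤1+n k))))

  coeff-last : ∀ B x → coeff (B ++ x ∷ []) (length B) ≡ x
  coeff-last []      x = refl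
  coeff-last (b ∷ B) x = coeff-last B x

  monic-≋⇒≡ : ∀ A B → (A ++ + 1 ∷ []) ≋ (B ++ + 1 ∷ []) → A ≡ B
  monic-≋⇒≡ []      []      p = refl
  monic-≋⇒≡ (a ∷ A) (b ∷ B) p = cong₂ _∷_ (at p zero) (monic-≋⇒≡ A B (∷-injectiveʳ p))
  monic-≋⇒≡ []      (b ∷ B) p with trans (at p (suc (length B))) (coeff-last B (+ 1))
  ... | ()
  monic-≋⇒≡ (a ∷ A) []      p with trans (sym (at p (suc (length A)))) (coeff-last A (+ 1))
  ... | ()

  monic-eq : ∀ {A B} → Monic A → Monic B → A ≋ B → A ≡ B
  monic-eq (A₀ , refl) (B₀ , refl) p = cong (_++ + 1 ∷ []) (monic-≋⇒≡ A₀ B₀ p)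

  monic-length-≤ : ∀ A B → Monic A → Monic B → length A ≤ length (A ⊛ B)
  monic-length-≤ A       []      _ ([]    , ())
  monic-length-≤ A       []      _ (_ ∷ _ , ())
  monic-length-≤ []      (y ∷ B) _ _ = z≤n
  monic-length-≤ (x ∷ A) (y ∷ B) _ _ rewrite length-⊛ x A y B = s≤s (ℕP.m≤m+n (length A) (length B))

  reverse-∷ʳ : ∀ (xs : Poly) x → reverse (xs ++ x ∷ []) ≡ x ∷ reverse xs
  reverse-∷ʳ xs x = ListP.reverse-++ xs (x ∷ [])

  reverse-⊕-reverse : ∀ rP rW → length rP ≡ length rW → reverse (reverse rP ⊕ reverse rW) ≡ rP ⊕ rW
  reverse-⊕-reverse []       []       e = refl
  reverse-⊕-reverse (p ∷ rP) (w ∷ rW) e =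
    trans (cong₂ (λ u v → reverse (u ⊕ v)) (ListP.unfold-reverse p rP) (ListP.unfold-reverse w rW))
    (trans (cong reverse (++-∷ʳ-⊕ (reverse rP) (reverse rW) p w
             (trans (ListP.length-reverse rP) (trans (ℕP.suc-injective e) (sym (ListP.length-reverse rW))))))
    (trans (reverse-∷ʳ (reverse rP ⊕ reverse rW) (p + w))
           (cong (p + w ∷_) (reverse-⊕-reverse rP rW (ℕP.suc-injective e)))))

  reverse-⊕ : ∀ P W → length P ≡ length W → reverse (P ⊕ W) ≡ reverse P ⊕ reverse W
  reverse-⊕ P W e =
    trans (cong₂ (λ u v → reverse (u ⊕ v)) (sym (ListP.reverse-involutive P)) (sym (ListP.reverse-involutive W)))
          (reverse-⊕-reverse (reverse P) (reverse W)
            (trans (ListP.length-reverse P) (trans e (sym (ListP.length-reverse W)))))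

  reverse-zeros : ∀ n → reverse (zeros n) ≡ zeros n
  reverse-zeros zero    = refl
  reverse-zeros (suc n) =
    trans (ListP.unfold-reverse (+ 0) (zeros n)) (trans (cong (_++ + 0 ∷ []) (reverse-zeros n)) (zeros-∷ʳ n))
    where
    zeros-∷ʳ : ∀ n → zeros n ++ + 0 ∷ [] ≡ + 0 ∷ zeros n
    zeros-∷ʳ zero    = refl
    zeros-∷ʳ (suc n) = cong (+ 0 ∷_) (zeros-∷ʳ n)

  divH-step : ∀ f g ns dt → length dt ≤ length ns → divH (suc f) (g ∷ ns) dt ≡ g ∷ divH f (subScaled g dt ns) dt
  divH-step f g ns dt p with length dt ℕ.≤? length ns
  ... | yes _ = refl
  ... | no ¬p = ⊥-elim (¬p p)

  divH-zeros : ∀ f dt → divH f (zeros (length dt)) dt ≡ []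
  divH-zeros zero    dt = refl
  divH-zeros (suc f) [] = refl
  divH-zeros (suc f) (e ∷ dt) with length (e ∷ dt) ℕ.≤? length (zeros (length dt))
  ... | yes p = ⊥-elim (ℕP.1+n≰n (ℕP.≤-trans p (ℕP.≤-reflexive (length-zeros (length dt)))))
  ... | no _  = refl

  ⊕-zeros : ∀ X n → length X ≡ n → X ⊕ zeros n ≡ X
  ⊕-zeros []      zero    p = refl
  ⊕-zeros (x ∷ X) (suc n) p = cong₂ _∷_ (ℤP.+-identityʳ x) (⊕-zeros X n (ℕP.suc-injective p))

  subScaled-cancel : ∀ g dt X n → length X ≡ length dt ℕ.+ n → subScaled g dt (X ⊕ ((g ·ₚ dt) ++ zeros n)) ≡ X
  subScaled-cancel g []       X       n p = ⊕-zeros X n p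
  subScaled-cancel g (e ∷ dt) (x ∷ X) n p =
    cong₂ _∷_ (cancel x g e) (subScaled-cancel g dt X n (ℕP.suc-injective p))
    where
    cancel : ∀ x g e → (x + g * e) - g * e ≡ x
    cancel = ℤSolver.solve-∀

  subScaled-self : ∀ g dt → subScaled g dt (g ·ₚ dt) ≡ zeros (length dt)
  subScaled-self g []       = refl
  subScaled-self g (e ∷ dt) = cong₂ _∷_ (ℤP.+-inverseʳ (g * e)) (subScaled-self g dt)

  -- Long division by D = d₀ ∷ ds = rdt ++ [1], whose reversed tail is dt:
  -- dividing the reversed product reverse (G D) returns reverse G.  Peeling
  -- off the top coefficient g of G = G₀ + g q^|G₀| leaves reverse (G₀ D).
  module LongDivision (d₀ : ℤ) (ds rdt : Poly) (eD : d₀ ∷ ds ≡ rdt ++ + 1 ∷ []) where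
    D = d₀ ∷ ds
    dt = reverse rdt

    length-ds : length ds ≡ length rdt
    length-ds = ℕP.suc-injective (trans (cong length eD) (trans (ListP.length-++ rdt) (ℕP.+-comm (length rdt) 1)))

    -- q^|G₀| g rdt: the part of g q^|G₀| D below its top coefficient
    W : Poly → ℤ → Poly
    W G₀ g = zeros (length G₀) ++ (g ·ₚ rdt)

    length-W : ∀ G₀ g → length (W G₀ g) ≡ length G₀ ℕ.+ length rdt
    length-W G₀ g = trans (ListP.length-++ (zeros (length G₀))) (cong₂ ℕ._+_ (length-zeros (length G₀)) (length-· g rdt))

    length-⊛D-≤ : ∀ G₀ g → length (G₀ ⊛ D) ≤ length (W G₀ g)
    length-⊛D-≤ G₀ g = ℕP.≤-trans (length-⊛-≤ G₀ d₀ ds)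
      (ℕP.≤-reflexive (trans (cong (length G₀ ℕ.+_) length-ds) (sym (length-W G₀ g))))

    ∷ʳ-⊛D : ∀ G₀ g → (G₀ ++ g ∷ []) ⊛ D ≡ ((G₀ ⊛ D) ⊕ W G₀ g) ++ (g * + 1) ∷ []
    ∷ʳ-⊛D G₀ g = trans (∷ʳ-⊛ G₀ g d₀ ds)
      (trans (cong (λ u → (G₀ ⊛ D) ⊕ (zeros (length G₀) ++ u))
                   (trans (cong (g ·ₚ_) eD) (ListP.map-++ (g *_) rdt (+ 1 ∷ []))))
      (trans (cong ((G₀ ⊛ D) ⊕_) (sym (ListP.++-assoc (zeros (length G₀)) (g ·ₚ rdt) ((g * + 1) ∷ []))))
             (⊕-++-∷ʳ (G₀ ⊛ D) (W G₀ g) (g * + 1) (length-⊛D-≤ G₀ g))))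

    remainder : Poly → ℤ → Poly
    remainder G₀ g = reverse ((G₀ ⊛ D) ⊕ W G₀ g)

    reverse-⊛D : ∀ rG₀ g → reverse (reverse (g ∷ rG₀) ⊛ D) ≡ g ∷ remainder (reverse rG₀) g
    reverse-⊛D rG₀ g = trans (cong (λ u → reverse (u ⊛ D)) (ListP.unfold-reverse g rG₀))
      (trans (cong reverse (∷ʳ-⊛D (reverse rG₀) g))
      (trans (reverse-∷ʳ ((reverse rG₀ ⊛ D) ⊕ W (reverse rG₀) g) (g * + 1))
             (cong (_∷ remainder (reverse rG₀) g) (ℤP.*-identityʳ g))))

    remainder-long : ∀ G₀ g → length dt ≤ length (remainder G₀ g)
    remainder-long G₀ g = subst₂ _≤_ (sym (ListP.length-reverse rdt))
      (sym (trans (ListP.length-reverse ((G₀ ⊛ D) ⊕ W G₀ g)) (length-⊕ʳ (G₀ ⊛ D) (W G₀ g) (length-⊛D-≤ G₀ g))))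
      (ℕP.≤-trans (ℕP.m≤n+m (length rdt) (length G₀)) (ℕP.≤-reflexive (sym (length-W G₀ g))))

    reverse-g·rdt : ∀ g → reverse (g ·ₚ rdt) ≡ g ·ₚ dt
    reverse-g·rdt g = sym (ListP.reverse-map (g *_) rdt)

    subtract-top-[] : ∀ g → subScaled g dt (remainder [] g) ≡ zeros (length dt)
    subtract-top-[] g = trans (cong (subScaled g dt) (reverse-g·rdt g)) (subScaled-self g dt)

    subtract-top : ∀ x G₀' g → subScaled g dt (remainder (x ∷ G₀') g) ≡ reverse ((x ∷ G₀') ⊛ D)
    subtract-top x G₀' g =
      trans (cong (subScaled g dt) (trans (reverse-⊕ (G₀ ⊛ D) (W G₀ g) same-length)
        (cong (reverse (G₀ ⊛ D) ⊕_) (trans (ListP.reverse-++ (zeros (length G₀)) (g ·ₚ rdt))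
          (cong₂ _++_ (reverse-g·rdt g) (reverse-zeros (length G₀)))))))
      (subScaled-cancel g dt (reverse (G₀ ⊛ D)) (length G₀)
        (trans (ListP.length-reverse (G₀ ⊛ D)) (trans same-length (trans (length-W G₀ g)
          (trans (ℕP.+-comm (length G₀) (length rdt)) (cong (ℕ._+ length G₀) (sym (ListP.length-reverse rdt))))))))
      where
      G₀ = x ∷ G₀'
      same-length : length (G₀ ⊛ D) ≡ length (W G₀ g)
      same-length = trans (length-⊛ x G₀' d₀ ds) (trans (cong (length G₀ ℕ.+_) length-ds) (sym (length-W G₀ g)))

    subtract-top-∷ʳ : ∀ h rG₀ g → subScaled g dt (remainder (reverse (h ∷ rG₀)) g) ≡ reverse (reverse (h ∷ rG₀) ⊛ D)
    subtract-top-∷ʳ h rG₀ g rewrite ListP.unfold-reverse h rG₀ with reverse rG₀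
    ... | []      = subtract-top h [] g
    ... | x ∷ G₀' = subtract-top x (G₀' ++ h ∷ []) g

    divide : ∀ rG f → length rG ≤ f → divH f (reverse (reverse rG ⊛ D)) dt ≡ rG
    divide []           zero    p       = refl
    divide []           (suc f) p       = refl
    divide (g ∷ [])     (suc f) (s≤s p) =
      trans (cong (λ u → divH (suc f) u dt) (reverse-⊛D [] g))
      (trans (divH-step f g (remainder [] g) dt (remainder-long [] g))
      (cong (g ∷_) (trans (cong (λ u → divH f u dt) (subtract-top-[] g)) (divH-zeros f dt))))
    divide (g ∷ h ∷ rG₀) (suc f) (s≤s p) =
      trans (cong (λ u → divH (suc f) u dt) (reverse-⊛D (h ∷ rG₀) g))
      (trans (divH-step f g (remainder (reverse (h ∷ rG₀)) g) dt (remainder-long (reverse (h ∷ rG₀)) g))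
      (cong (g ∷_) (trans (cong (λ u → divH f u dt) (subtract-top-∷ʳ h rG₀ g)) (divide (h ∷ rG₀) f p))))

  divide-by-monic : ∀ D rdt → D ≡ rdt ++ + 1 ∷ [] → ∀ rG f → length rG ≤ f →
    divH f (reverse (reverse rG ⊛ D)) (reverse rdt) ≡ rG
  divide-by-monic D []        refl = LongDivision.divide (+ 1) [] [] refl
  divide-by-monic D (x ∷ rdt) refl = LongDivision.divide x (rdt ++ + 1 ∷ []) (x ∷ rdt) refl

  divMonic-unfold : ∀ N D nh c dt → dropZeros (reverse N) ≡ nh → dropZeros (reverse D) ≡ c ∷ dt →
    divMonic N D ≡ reverse (divH (length nh) nh dt)
  divMonic-unfold N D nh c dt e₁ e₂ with dropZeros (reverse N) | dropZeros (reverse D)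
  divMonic-unfold N D nh c dt refl refl | _ | _ = refl

  -- a reversed monic list starts with 1, so no zeros are dropped
  dropZeros-monic : ∀ A → Monic A → dropZeros (reverse A) ≡ reverse A
  dropZeros-monic _ (A₀ , refl) rewrite reverse-∷ʳ A₀ (+ 1) = refl

  divMonic-⊛ : ∀ A D → Monic A → Monic D → divMonic (A ⊛ D) D ≡ A
  divMonic-⊛ A D mA (rdt , eD) =
    trans (divMonic-unfold (A ⊛ D) D (reverse (A ⊛ D)) (+ 1) (reverse rdt)
            (dropZeros-monic (A ⊛ D) (monic-⊛ A D mA (rdt , eD)))
            (cong dropZeros (trans (cong reverse eD) (reverse-∷ʳ rdt (+ 1)))))
    (trans (cong (λ u → reverse (divH (length (reverse (u ⊛ D))) (reverse (u ⊛ D)) (reverse rdt)))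
                 (sym (ListP.reverse-involutive A)))
    (trans (cong reverse (divide-by-monic D rdt eD (reverse A) _ fuel)) (ListP.reverse-involutive A)))
    where
    fuel : length (reverse A) ≤ length (reverse (reverse (reverse A) ⊛ D))
    fuel rewrite ListP.reverse-involutive A | ListP.length-reverse A | ListP.length-reverse (A ⊛ D) =
      monic-length-≤ A D mA (rdt , eD)

  qmultinom-G : ∀ r k → qmultinom (+ r ∷ + k ∷ []) ≡ G r k
  qmultinom-G r k =
    trans (cong (λ N → divMonic N D) product) (divMonic-⊛ (G r k) D (monic-G r k) monic-D)
    where
    D = qfact r ⊛ (qfact k ⊛ one)
    monic-D : Monic D
    monic-D = monic-⊛ (qfact r) (qfact k ⊛ one) (monic-qfact r) (monic-⊛ (qfact k) one (monic-qfact k) ([] , refl))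
    product : qfact (r ℕ.+ (k ℕ.+ 0)) ≡ G r k ⊛ D
    product rewrite ℕP.+-identityʳ k =
      monic-eq (monic-qfact (r ℕ.+ k)) (monic-⊛ (G r k) D (monic-G r k) monic-D)
        (≋-trans (factorial-split r k) (⊛-congʳ (G r k) (⊛-congʳ (qfact r) (≋-sym (⊛-one (qfact k))))))

open ExactDivision using (qmultinom-G)

module Summation {c ℓ : Level} (S : CommutativeSemiring c ℓ) where
  open CommutativeSemiring S
  open import Data.Nat using (_≤_)
  open import Function using (_∘_)
  open import Relation.Binary.Reasoning.Setoid setoid
  open NaturalSolver S (λ _ _ → nothing) using (solve; _:+_; _:*_; _:=_)

  Σ< : (ℕ → Carrier) → ℕ → Carrier
  Σ< f zero    = 0#
  Σ< f (suc K) = Σ< f K + f K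

  Σ<-first : ∀ f K → Σ< f (suc K) ≈ f 0 + Σ< (f ∘ suc) K
  Σ<-first f zero    = trans (+-identityˡ _) (sym (+-identityʳ _))
  Σ<-first f (suc K) = trans (+-congʳ (Σ<-first f K)) (+-assoc _ _ _)

  foldr-applyUpTo : ∀ f K → foldr _+_ 0# (applyUpTo f K) ≈ Σ< f K
  foldr-applyUpTo f zero    = refl
  foldr-applyUpTo f (suc K) = trans (+-congˡ (foldr-applyUpTo (f ∘ suc) K)) (sym (Σ<-first f K))

  Σ<-cong : ∀ {f g} K → (∀ n → f n ≈ g n) → Σ< f K ≈ Σ< g K
  Σ<-cong zero    h = refl
  Σ<-cong (suc K) h = +-cong (Σ<-cong K h) (h K)

  *-Σ< : ∀ x f K → x * Σ< f K ≈ Σ< (λ n → x * f n) K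
  *-Σ< x f zero    = zeroʳ x
  *-Σ< x f (suc K) = trans (distribˡ x _ _) (+-congʳ (*-Σ< x f K))

  Σ<-extend : ∀ f K K' → K ≤ K' → (∀ n → K ≤ n → f n ≈ 0#) → Σ< f K' ≈ Σ< f K
  Σ<-extend f K K' K≤K' vanish =
    trans (reflexive (≡.cong (Σ< f) (≡.sym (ℕP.m∸n+n≡m K≤K')))) (extend (K' ℕ.∸ K))
    where
    extend : ∀ j → Σ< f (j ℕ.+ K) ≈ Σ< f K
    extend zero    = refl
    extend (suc j) = trans (+-cong (extend j) (vanish (j ℕ.+ K) (ℕP.m≤n+m K j))) (+-identityʳ _)

  -- The partial sums differ by the boundary term c F(K) E'(K-1).
  module SummationByParts (F g₁ g₂ E E' : ℕ → Carrier) (c c₀ : Carrier)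
           (E'-zero : E' 0 ≈ E 0) (E'-suc : ∀ n → E' (suc n) ≈ E (suc n) + c * E' n)
           (F-step : ∀ n → F n + c₀ * g₂ n ≈ g₁ n + c * F (suc n)) where

    boundary : ℕ → Carrier
    boundary zero    = 0#
    boundary (suc K) = c * F (suc K) * E' K

    boundary-absorbs : ∀ K → boundary K + F K * E K ≈ F K * E' K
    boundary-absorbs zero    = trans (+-identityˡ _) (*-congˡ (sym E'-zero))
    boundary-absorbs (suc K) = begin
      c * F (suc K) * E' K + F (suc K) * E (suc K)
        ≈⟨ solve 4 (λ c f e' e → c :* f :* e' :+ f :* e := f :* (e :+ c :* e')) refl c (F (suc K)) (E' K) (E (suc K)) ⟩
      F (suc K) * (E (suc K) + c * E' K)
        ≈⟨ *-congˡ (sym (E'-suc K)) ⟩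
      F (suc K) * E' (suc K) ∎

    partial-sums : ∀ K → Σ< (λ n → F n * E n) K + Σ< (λ n → c₀ * (g₂ n * E' n)) K
                         ≈ Σ< (λ n → g₁ n * E' n) K + boundary K
    partial-sums zero    = refl
    partial-sums (suc K) = begin
      (A + F K * E K) + (B + c₀ * (g₂ K * E' K))
        ≈⟨ solve 4 (λ a x b y → (a :+ x) :+ (b :+ y) := (a :+ b) :+ (x :+ y)) refl A (F K * E K) B (c₀ * (g₂ K * E' K)) ⟩
      (A + B) + (F K * E K + c₀ * (g₂ K * E' K))
        ≈⟨ +-congʳ (partial-sums K) ⟩
      (C + boundary K) + (F K * E K + c₀ * (g₂ K * E' K))
        ≈⟨ solve 4 (λ c x y z → (c :+ x) :+ (y :+ z) := c :+ ((x :+ y) :+ z)) refl C (boundary K) (F K * E K) (c₀ * (g₂ K * E' K)) ⟩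
      C + ((boundary K + F K * E K) + c₀ * (g₂ K * E' K))
        ≈⟨ +-congˡ (+-congʳ (boundary-absorbs K)) ⟩
      C + (F K * E' K + c₀ * (g₂ K * E' K))
        ≈⟨ +-congˡ (solve 4 (λ f e c₀ g → f :* e :+ c₀ :* (g :* e) := (f :+ c₀ :* g) :* e) refl (F K) (E' K) c₀ (g₂ K)) ⟩
      C + (F K + c₀ * g₂ K) * E' K
        ≈⟨ +-congˡ (*-congʳ (F-step K)) ⟩
      C + (g₁ K + c * F (suc K)) * E' K
        ≈⟨ solve 5 (λ C g e c f → C :+ (g :+ c :* f) :* e := (C :+ g :* e) :+ c :* f :* e) refl C (g₁ K) (E' K) c (F (suc K)) ⟩
      (C + g₁ K * E' K) + c * F (suc K) * E' K ∎
      where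
      A = Σ< (λ n → F n * E n) K
      B = Σ< (λ n → c₀ * (g₂ n * E' n)) K
      C = Σ< (λ n → g₁ n * E' n) K

    summation-by-parts : ∀ K → F K ≈ 0# →
      Σ< (λ n → F n * E n) K + c₀ * Σ< (λ n → g₂ n * E' n) K ≈ Σ< (λ n → g₁ n * E' n) K
    summation-by-parts K F-K≈0 =
      trans (+-congˡ (*-Σ< c₀ _ K)) (trans (partial-sums K) (trans (+-congˡ (no-boundary K F-K≈0)) (+-identityʳ _)))
      where
      no-boundary : ∀ K → F K ≈ 0# → boundary K ≈ 0#
      no-boundary zero    _ = refl
      no-boundary (suc K) h = trans (*-congʳ (trans (*-congˡ h) (zeroʳ c))) (zeroˡ _)

  open SummationByParts public using (summation-by-parts)

  -- The pointwise identity behind the recurrence: expand Y = A + p₁ A⁻ and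
  -- D = C + p₂ C⁻ and match the monomial factors.
  expand-pascal-pair : ∀ {u u₂ u' c₀ c p₁ p₂ A A⁻ C C⁻ Y D} →
    Y ≈ A + p₁ * A⁻ → D ≈ C + p₂ * C⁻ → c₀ * u₂ ≈ u * p₁ → (c₀ * u₂) * p₂ ≈ c * u' →
    (u * A) * C + c₀ * ((u₂ * A⁻) * D) ≈ (u * Y) * C + c * ((u' * A⁻) * C⁻)
  expand-pascal-pair {u} {u₂} {u'} {c₀} {c} {p₁} {p₂} {A} {A⁻} {C} {C⁻} {Y} {D} hY hD h₁ h₂ = begin
    (u * A) * C + c₀ * ((u₂ * A⁻) * D)
      ≈⟨ +-congˡ (*-congˡ (*-congˡ hD)) ⟩
    (u * A) * C + c₀ * ((u₂ * A⁻) * (C + p₂ * C⁻))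
      ≈⟨ solve 8 (λ u a cc c₀ u₂ am p₂ cm →
           (u :* a) :* cc :+ c₀ :* ((u₂ :* am) :* (cc :+ p₂ :* cm))
             := (u :* a) :* cc :+ (c₀ :* u₂) :* am :* cc :+ ((c₀ :* u₂) :* p₂) :* (am :* cm))
           refl u A C c₀ u₂ A⁻ p₂ C⁻ ⟩
    (u * A) * C + (c₀ * u₂) * A⁻ * C + ((c₀ * u₂) * p₂) * (A⁻ * C⁻)
      ≈⟨ +-cong (+-congˡ (*-congʳ (*-congʳ h₁))) (*-congʳ h₂) ⟩
    (u * A) * C + (u * p₁) * A⁻ * C + (c * u') * (A⁻ * C⁻)
      ≈⟨ solve 8 (λ u a cc p₁ am c u' cm →
           (u :* a) :* cc :+ (u :* p₁) :* am :* cc :+ (c :* u') :* (am :* cm)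
             := (u :* (a :+ p₁ :* am)) :* cc :+ c :* ((u' :* am) :* cm))
           refl u A C p₁ A⁻ c u' C⁻ ⟩
    (u * (A + p₁ * A⁻)) * C + c * ((u' * A⁻) * C⁻)
      ≈⟨ +-congʳ (*-congʳ (*-congˡ (sym hY))) ⟩
    (u * Y) * C + c * ((u' * A⁻) * C⁻) ∎

module IndexArithmetic where
  open import Data.Integer using (_+_; _-_; _*_; -_)
  open ℤSolver using (solve-∀)

  pred-suc : ∀ r → (+ 1 + r) - + 1 ≡ r
  pred-suc = solve-∀

  pascal-top-gap : ∀ r k → ((+ 1 + (r + k)) + + 1) - (+ 1 + r) ≡ + 1 + k
  pascal-top-gap = solve-∀

  pascal-same-gap : ∀ r k → (+ 1 + (r + k)) - (+ 1 + r) ≡ k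
  pascal-same-gap = solve-∀

  pascal-lower-gap : ∀ r k → (+ 1 + (r + k)) - r ≡ + 1 + k
  pascal-lower-gap = solve-∀

  bottom-gap : ∀ n → (n + + 1) - + 0 ≡ + 1 + n
  bottom-gap = solve-∀

  gap-at-top : ∀ n → (n + + 1) - (+ 1 + n) ≡ + 0
  gap-at-top = solve-∀

  one-beyond : ∀ n → n - (+ 1 + n) ≡ - (+ 1)
  one-beyond = solve-∀

  beyond₁ : ∀ n j → (n + + 1) - (+ 1 + (n + (+ 1 + j))) ≡ - (+ 1 + j)
  beyond₁ = solve-∀

  beyond₂ : ∀ n j → n - (+ 1 + (n + (+ 1 + j))) ≡ - (+ 1 + (+ 1 + j))
  beyond₂ = solve-∀

  beyond₃ : ∀ n j → n - (n + (+ 1 + j)) ≡ - (+ 1 + j)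
  beyond₃ = solve-∀


  tail-shift : ∀ s l n → (s + + 1) - l + n ≡ (s - l + n) + + 1
  tail-shift = solve-∀

  tail-gap : ∀ s l n → ((s - l + (+ 1 + n)) + + 1) - (+ 1 + n) ≡ s - l + + 1
  tail-gap = solve-∀

  tail-lower : ∀ s l n → s - l + (+ 1 + n) ≡ (s + + 1) - l + n
  tail-lower = solve-∀

  shift-complement : ∀ s a → (s + + 1) - a ≡ (s - a) + + 1
  shift-complement = solve-∀

  shift-both : ∀ s a → (s + + 1) - (a + + 1) ≡ s - a
  shift-both = solve-∀

  lower-gap : ∀ P N → (P - N) - + 1 ≡ P - (+ 1 + N)
  lower-gap = solve-∀

  lower-first : ∀ P N → (P - + 1) - N ≡ P - (+ 1 + N)
  lower-first = solve-∀

  exponent-match₁ : ∀ s a l P Q N →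
    (s - a - P + + 1) + N * (N + l - ((P - + 1) + Q)) ≡ N * (N + l - (P + Q)) + (((s - a) + + 1) - (P - N))
  exponent-match₁ = solve-∀

  exponent-match₂ : ∀ s a l P Q N →
    ((s - a - P + + 1) + N * (N + l - ((P - + 1) + Q))) + ((a + + 1) - (Q - N))
      ≡ (s - l + + 1) + (+ 1 + N) * ((+ 1 + N) + l - (P + Q))
  exponent-match₂ = solve-∀

  β-exponent : ∀ N x y l m → N * (((N - (x + y)) + l) - (+ 2 * m)) ≡ N * (N + l - ((x + m) + (y + m)))
  β-exponent = solve-∀

  complement-left : ∀ a a' → (a + a') - a ≡ a'
  complement-left = solve-∀

  complement-right : ∀ a a' → (a + a') - a' ≡ a
  complement-right = solve-∀

  -- reflecting a ↦ s + 1 - a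
  reflect₁ : ∀ s a → (a - + 1) + ((s + + 1) - a) ≡ s
  reflect₁ = solve-∀

  reflect₂ : ∀ s a → (a - + 1) + (((s + + 1) - a) + + 1) ≡ s + + 1
  reflect₂ = solve-∀

  reflect₃ : ∀ s a → ((s + + 1) - a) + a ≡ s + + 1
  reflect₃ = solve-∀

  reflect-exponent : ∀ s a Q → a - Q ≡ s - ((s + + 1) - a) - Q + + 1
  reflect-exponent = solve-∀

  abs-split : ∀ b → + ∣ b ∣ ≡ b ₊ + b ₋
  abs-split (+ n)    = ≡.sym (ℤP.+-identityʳ (+ n))
  abs-split -[1+ n ] = ≡.refl

  ₊≤abs : ∀ b → b ₊ ℤ.≤ + ∣ b ∣
  ₊≤abs (+ n)    = ℤP.≤-refl
  ₊≤abs -[1+ n ] = ℤ.+≤+ z≤n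

  abs-bound : ∀ b m K → b ₊ + m ℤ.< K → b ₋ + m ℤ.< K → + ∣ b ∣ + m ℤ.< K
  abs-bound (+ n)    m K h _ = h
  abs-bound -[1+ n ] m K _ h = h

  below-suc : ∀ x n → ∣ x ∣ ℕ.≤ n → x ℤ.< + suc n
  below-suc (+ k)    n h = ℤ.+<+ (s≤s h)
  below-suc -[1+ k ] n h = ℤ.-<+

  pred-< : ∀ {x K} → x ℤ.< K → x - + 1 ℤ.< K
  pred-< {x} h = ℤP.≤-<-trans (ℤP.i-j≤i x (+ 1)) h

  negative-gap : ∀ x n → x ℤ.< + n → x - + n ℤ.< + 0
  negative-gap x n h = ≡.subst (x - + n ℤ.<_) (ℤP.+-inverseʳ (+ n)) (ℤP.+-monoˡ-< (- + n) h)

  reflect-nonneg : ∀ {s a} → a ℤ.≤ s → + 0 ℤ.≤ (s + + 1) - a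
  reflect-nonneg {s} a≤s = ℤP.i≤j⇒0≤j-i (ℤP.≤-trans a≤s (ℤP.i≤i+j s (+ 1)))

  reflect-≤ : ∀ {s a} → + 0 ℤ.< a → (s + + 1) - a ℤ.≤ s
  reflect-≤ {s} {a} 0<a = ≡.subst ((s + + 1) - a ℤ.≤_) (cancel-one s)
    (ℤP.+-monoʳ-≤ (s + + 1) (ℤP.neg-mono-≤ (ℤP.i<j⇒suc[i]≤j 0<a)))
    where
    cancel-one : ∀ s → (s + + 1) - + 1 ≡ s
    cancel-one = solve-∀

  down-one : ∀ k m → k + m ≡ ((+ 1 + k) + m) - + 1
  down-one = solve-∀

  up-one : ∀ k m → (k + + 1) + (m - + 1) ≡ k + m
  up-one = solve-∀

  one-more : ∀ k m → (+ 1 + k) + (m - + 1) ≡ k + m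
  one-more = solve-∀

  zero-lower : ∀ m → + 0 + (m - + 1) ≡ (+ 0 + m) - + 1
  zero-lower = solve-∀

  lowering-positive : ∀ s a b m → + 0 ℤ.< b →
      ((b - + 1) ₊ + m ≡ (b ₊ + m) - + 1) × ((b - + 1) ₋ + m ≡ b ₋ + m)
    × (s - a - b - m + + 1 ≡ s - a - (b ₊ + m) + + 1)
  lowering-positive s a (+ suc k) m _ = down-one (+ k) m , ≡.refl , regroup s a (+ suc k) m
    where
    regroup : ∀ s a b m → s - a - b - m + + 1 ≡ s - a - (b + m) + + 1
    regroup = solve-∀
  lowering-positive s a (+ zero) m (ℤ.+<+ ())

  drop-zero : ∀ s a m → s - a - m + + 1 ≡ s - a - (+ 0 + m) + + 1
  drop-zero = solve-∀

  lowering-nonpositive : ∀ s a b m → b ℤ.≤ + 0 →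
      ((b - + 1) ₊ + (m - + 1) ≡ (b ₊ + m) - + 1) × ((b - + 1) ₋ + (m - + 1) ≡ b ₋ + m)
    × (s - a - m + + 1 ≡ s - a - (b ₊ + m) + + 1)
  lowering-nonpositive s a (+ zero)  m _ = zero-lower m , one-more (+ 0) m , drop-zero s a m
  lowering-nonpositive s a (+ suc k) m (ℤ.+≤+ ())
  lowering-nonpositive s a -[1+ k ] m _ rewrite ℕP.+-identityʳ k =
    zero-lower m , one-more (+ suc k) m , drop-zero s a m

  raising-nonnegative : ∀ a b m → + 0 ℤ.≤ b →
      ((b + + 1) ₊ + (m - + 1) ≡ b ₊ + m) × ((b + + 1) ₋ + (m - + 1) ≡ (b ₋ + m) - + 1)
    × (a - m ≡ a - (b ₋ + m))
  raising-nonnegative a (+ k) m _ = up-one (+ k) m , zero-lower m , regroup a m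
    where
    regroup : ∀ a m → a - m ≡ a - (+ 0 + m)
    regroup = solve-∀

  negate-regroup : ∀ a k m → a + (- k) - m ≡ a - (k + m)
  negate-regroup = solve-∀

  raising-negative : ∀ a b m → b ℤ.< + 0 →
      ((b + + 1) ₊ + m ≡ b ₊ + m) × ((b + + 1) ₋ + m ≡ (b ₋ + m) - + 1)
    × (a + b - m ≡ a - (b ₋ + m))
  raising-negative a -[1+ zero ]  m _ = ≡.refl , down-one (+ 0) m , negate-regroup a (+ 1) m
  raising-negative a -[1+ suc k ] m _ = ≡.refl , down-one (+ suc k) m , negate-regroup a (+ suc (suc k)) m
  raising-negative a (+ k)        m (ℤ.+<+ ())

open IndexArithmetic

module Evaluation {c ℓ : Level} (R : CommutativeRing c ℓ) (q q⁻¹ : CommutativeRing.Carrier R)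
                  (q·q⁻¹≈1 : CommutativeRing._≈_ R (CommutativeRing._*_ R q q⁻¹) (CommutativeRing.1# R)) where
  open CommutativeRing R
  open Eval R q q⁻¹
  open import Algebra.Properties.Ring ring using (-0#≈0#; -‿+-comm)
  open import Data.Integer using (_⊖_)
  open import Relation.Binary.Reasoning.Setoid setoid
  open NaturalSolver commutativeSemiring (λ _ _ → nothing) using (solve; _:+_; _:*_; _:=_)

  natR-+ : ∀ m n → natR (m ℕ.+ n) ≈ natR m + natR n
  natR-+ zero    n = sym (+-identityˡ _)
  natR-+ (suc m) n = trans (+-congˡ (natR-+ m n)) (sym (+-assoc _ _ _))

  natR-⊖ : ∀ m n → intR (m ⊖ n) ≈ natR m + - natR n
  natR-⊖ m       zero    = trans (sym (+-identityʳ _)) (+-congˡ (sym -0#≈0#))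
  natR-⊖ zero    (suc n) = sym (+-identityˡ _)
  natR-⊖ (suc m) (suc n) rewrite ℤP.[1+m]⊖[1+n]≡m⊖n m n = begin
    intR (m ⊖ n)                          ≈⟨ natR-⊖ m n ⟩
    natR m + - natR n                     ≈⟨ sym (+-identityˡ _) ⟩
    0# + (natR m + - natR n)              ≈⟨ +-congʳ (sym (-‿inverseʳ 1#)) ⟩
    (1# + - 1#) + (natR m + - natR n)
      ≈⟨ solve 4 (λ a b c d → (a :+ b) :+ (c :+ d) := (a :+ c) :+ (b :+ d)) refl 1# (- 1#) (natR m) (- natR n) ⟩
    (1# + natR m) + (- 1# + - natR n)     ≈⟨ +-congˡ (-‿+-comm 1# (natR n)) ⟩
    (1# + natR m) + - (1# + natR n)       ∎

  intR-+ : ∀ x y → intR (x ℤ.+ y) ≈ intR x + intR y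
  intR-+ (+ m)    (+ n)    = natR-+ m n
  intR-+ (+ m)    -[1+ n ] = natR-⊖ m (suc n)
  intR-+ -[1+ m ] (+ n)    = trans (natR-⊖ n (suc m)) (+-comm _ _)
  intR-+ -[1+ m ] -[1+ n ] = begin
    - natR (suc (suc (m ℕ.+ n)))     ≈⟨ -‿cong (reflexive (≡.cong (λ u → natR (suc u)) (≡.sym (ℕP.+-suc m n)))) ⟩
    - natR (suc m ℕ.+ suc n)         ≈⟨ -‿cong (natR-+ (suc m) (suc n)) ⟩
    - (natR (suc m) + natR (suc n))  ≈⟨ sym (-‿+-comm _ _) ⟩
    - natR (suc m) + - natR (suc n)  ∎

  ev-⊕ : ∀ a b → ev (a ⊕ b) ≈ ev a + ev b
  ev-⊕ []      b       = sym (+-identityˡ _)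
  ev-⊕ (x ∷ a) []      = sym (+-identityʳ _)
  ev-⊕ (x ∷ a) (y ∷ b) = begin
    intR (x ℤ.+ y) + q * ev (a ⊕ b)        ≈⟨ +-cong (intR-+ x y) (*-congˡ (ev-⊕ a b)) ⟩
    (intR x + intR y) + q * (ev a + ev b)
      ≈⟨ solve 5 (λ x y q a b → (x :+ y) :+ q :* (a :+ b) := (x :+ q :* a) :+ (y :+ q :* b)) refl (intR x) (intR y) q (ev a) (ev b) ⟩
    (intR x + q * ev a) + (intR y + q * ev b) ∎

  ev-zeros-++ : ∀ j p → ev (zeros j ++ p) ≈ powN q j * ev p
  ev-zeros-++ zero    p = sym (*-identityˡ _)
  ev-zeros-++ (suc j) p = trans (+-identityˡ _) (trans (*-congˡ (ev-zeros-++ j p)) (sym (*-assoc _ _ _)))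

  ev-one : ev one ≈ 1#
  ev-one = trans (+-congˡ (zeroʳ q)) (trans (+-identityʳ _) (+-identityʳ 1#))

  powN-+ : ∀ x m n → powN x (m ℕ.+ n) ≈ powN x m * powN x n
  powN-+ x zero    n = sym (*-identityˡ _)
  powN-+ x (suc m) n = trans (*-congˡ (powN-+ x m n)) (sym (*-assoc _ _ _))

  qpow-⊖ : ∀ m n → qpow (m ⊖ n) ≈ powN q m * powN q⁻¹ n
  qpow-⊖ m       zero    = sym (*-identityʳ _)
  qpow-⊖ zero    (suc n) = sym (*-identityˡ _)
  qpow-⊖ (suc m) (suc n) rewrite ℤP.[1+m]⊖[1+n]≡m⊖n m n = begin
    qpow (m ⊖ n)                           ≈⟨ qpow-⊖ m n ⟩
    powN q m * powN q⁻¹ n                  ≈⟨ sym (*-identityˡ _) ⟩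
    1# * (powN q m * powN q⁻¹ n)           ≈⟨ *-congʳ (sym q·q⁻¹≈1) ⟩
    (q * q⁻¹) * (powN q m * powN q⁻¹ n)
      ≈⟨ solve 4 (λ a b c d → (a :* b) :* (c :* d) := (a :* c) :* (b :* d)) refl q q⁻¹ (powN q m) (powN q⁻¹ n) ⟩
    (q * powN q m) * (q⁻¹ * powN q⁻¹ n)    ∎

  qpow-+ : ∀ x y → qpow (x ℤ.+ y) ≈ qpow x * qpow y
  qpow-+ (+ m)    (+ n)    = powN-+ q m n
  qpow-+ (+ m)    -[1+ n ] = qpow-⊖ m (suc n)
  qpow-+ -[1+ m ] (+ n)    = trans (qpow-⊖ n (suc m)) (*-comm _ _)
  qpow-+ -[1+ m ] -[1+ n ] =
    trans (reflexive (≡.cong (λ u → powN q⁻¹ (suc u)) (≡.sym (ℕP.+-suc m n)))) (powN-+ q⁻¹ (suc m) (suc n))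

  qpow-cong : ∀ {x y} → x ≡ y → qpow x ≈ qpow y
  qpow-cong ≡.refl = refl

  qpow-balance : ∀ x y x' y' → x ℤ.+ y ≡ x' ℤ.+ y' → qpow x * qpow y ≈ qpow x' * qpow y'
  qpow-balance x y x' y' e = trans (sym (qpow-+ x y)) (trans (qpow-cong e) (qpow-+ x' y'))

  gauss : ℤ → ℤ → Carrier
  gauss N r = ev (qbinom N r)

  gauss-cong : ∀ {N N' r r'} → N ≡ N' → r ≡ r' → gauss N r ≈ gauss N' r'
  gauss-cong ≡.refl ≡.refl = refl

  gauss-congˡ : ∀ {N N'} r → N ≡ N' → gauss N r ≈ gauss N' r
  gauss-congˡ r ≡.refl = refl

  gauss-congʳ : ∀ N {r r'} → r ≡ r' → gauss N r ≈ gauss N r'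
  gauss-congʳ N ≡.refl = refl

  gauss-negative : ∀ N r → r ℤ.< + 0 → gauss N r ≈ 0#
  gauss-negative N -[1+ x ] _ = refl
  gauss-negative N (+ x) (ℤ.+<+ ())

  gauss-above : ∀ N r x → N ℤ.- + r ≡ -[1+ x ] → gauss N (+ r) ≈ 0#
  gauss-above N r x e rewrite e = refl

  gauss-G : ∀ N r k → N ℤ.- + r ≡ + k → gauss N (+ r) ≈ ev (G r k)
  gauss-G N r k e rewrite e | qmultinom-G r k = refl

  ev-G-zero : ∀ r → ev (G r 0) ≈ 1#
  ev-G-zero zero    = ev-one
  ev-G-zero (suc r) = ev-one

  ev-G-pascal : ∀ r k → ev (G (suc r) (suc k)) ≈ ev (G (suc r) k) + powN q (suc k) * ev (G r (suc k))
  ev-G-pascal r k = trans (ev-⊕ (G (suc r) k) _) (+-congˡ (ev-zeros-++ (suc k) (G r (suc k))))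

  PascalAt : ℕ → ℤ → Set ℓ
  PascalAt n r = gauss (+ n ℤ.+ + 1) r ≈ gauss (+ n) r + qpow (+ n ℤ.+ + 1 ℤ.- r) * gauss (+ n) (r ℤ.- + 1)

  vanishing-rhs : ∀ x → 0# ≈ 0# + x * 0#
  vanishing-rhs x = sym (trans (+-identityˡ _) (zeroʳ x))

  -- 0 < r ≤ n:  the recursion of G
  pascal-inside : ∀ r k → PascalAt (suc (r ℕ.+ k)) (+ suc r)
  pascal-inside r k = begin
    gauss (+ n ℤ.+ + 1) (+ suc r)
      ≈⟨ gauss-G (+ n ℤ.+ + 1) (suc r) (suc k) (pascal-top-gap (+ r) (+ k)) ⟩
    ev (G (suc r) (suc k))
      ≈⟨ ev-G-pascal r k ⟩
    ev (G (suc r) k) + powN q (suc k) * ev (G r (suc k))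
      ≈⟨ +-cong (sym (gauss-G (+ n) (suc r) k (pascal-same-gap (+ r) (+ k))))
                (*-cong (qpow-cong (≡.sym (pascal-top-gap (+ r) (+ k))))
                        (sym (trans (gauss-congʳ (+ n) (pred-suc (+ r))) (gauss-G (+ n) r (suc k) (pascal-lower-gap (+ r) (+ k)))))) ⟩
    gauss (+ n) (+ suc r) + qpow (+ n ℤ.+ + 1 ℤ.- + suc r) * gauss (+ n) (+ suc r ℤ.- + 1) ∎
    where
    n = suc (r ℕ.+ k)

  -- r = n + 1:  1 = 0 + q⁰·1
  pascal-top : ∀ n → PascalAt n (+ suc n)
  pascal-top n = begin
    gauss (+ n ℤ.+ + 1) (+ suc n)  ≈⟨ trans (gauss-G (+ n ℤ.+ + 1) (suc n) 0 (gap-at-top (+ n))) (ev-G-zero (suc n)) ⟩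
    1#                           ≈⟨ sym (trans (+-identityˡ _) (*-identityˡ _)) ⟩
    0# + 1# * 1#
      ≈⟨ +-cong (sym (gauss-above (+ n) (suc n) 0 (one-beyond (+ n))))
                (*-cong (qpow-cong (≡.sym (gap-at-top (+ n))))
                        (sym (trans (gauss-congʳ (+ n) (pred-suc (+ n))) (trans (gauss-G (+ n) n 0 (ℤP.+-inverseʳ (+ n))) (ev-G-zero n))))) ⟩
    gauss (+ n) (+ suc n) + qpow (+ n ℤ.+ + 1 ℤ.- + suc n) * gauss (+ n) (+ suc n ℤ.- + 1) ∎

  -- r > n + 1:  every coefficient vanishes
  pascal-beyond : ∀ n j → PascalAt n (+ suc (n ℕ.+ suc j))
  pascal-beyond n j = begin
    gauss (+ n ℤ.+ + 1) (+ suc r)  ≈⟨ gauss-above (+ n ℤ.+ + 1) (suc r) j (beyond₁ (+ n) (+ j)) ⟩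
    0#                           ≈⟨ vanishing-rhs (qpow (+ n ℤ.+ + 1 ℤ.- + suc r)) ⟩
    0# + qpow (+ n ℤ.+ + 1 ℤ.- + suc r) * 0#
      ≈⟨ +-cong (sym (gauss-above (+ n) (suc r) (suc j) (beyond₂ (+ n) (+ j))))
                (*-congˡ (sym (trans (gauss-congʳ (+ n) (pred-suc (+ r))) (gauss-above (+ n) r j (beyond₃ (+ n) (+ j)))))) ⟩
    gauss (+ n) (+ suc r) + qpow (+ n ℤ.+ + 1 ℤ.- + suc r) * gauss (+ n) (+ suc r ℤ.- + 1) ∎
    where
    r = n ℕ.+ suc j

  -- r = 0:  1 = 1 + q^{n+1}·0
  pascal-bottom : ∀ n → PascalAt n (+ 0)
  pascal-bottom n = begin
    gauss (+ n ℤ.+ + 1) (+ 0)  ≈⟨ gauss-G (+ n ℤ.+ + 1) 0 (suc n) (bottom-gap (+ n)) ⟩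
    ev one                   ≈⟨ sym (trans (+-congˡ (zeroʳ _)) (+-identityʳ _)) ⟩
    ev one + qpow (+ n ℤ.+ + 1 ℤ.- + 0) * 0#
      ≈⟨ +-congʳ (sym (gauss-G (+ n) 0 n (ℤP.+-identityʳ _))) ⟩
    gauss (+ n) (+ 0) + qpow (+ n ℤ.+ + 1 ℤ.- + 0) * gauss (+ n) (+ 0 ℤ.- + 1) ∎

  pascalAt : ∀ n r → PascalAt n r
  pascalAt n -[1+ x ]  = vanishing-rhs _
  pascalAt n (+ zero)  = pascal-bottom n
  pascalAt n (+ suc r) with ℕP.<-cmp r n
  ... | tri< r<n _ _ =
    ≡.subst (λ u → PascalAt u (+ suc r)) (ℕP.m+[n∸m]≡n r<n) (pascal-inside r (n ℕ.∸ suc r))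
  ... | tri≈ _ ≡.refl _ = pascal-top n
  ... | tri> _ _ r>n =
    ≡.subst (λ u → PascalAt n (+ suc u)) (≡.trans (ℕP.+-suc n (r ℕ.∸ suc n)) (ℕP.m+[n∸m]≡n r>n))
            (pascal-beyond n (r ℕ.∸ suc n))

  q-pascal : ∀ N r → + 0 ℤ.≤ N → gauss (N ℤ.+ + 1) r ≈ gauss N r + qpow (N ℤ.+ + 1 ℤ.- r) * gauss N (r ℤ.- + 1)
  q-pascal (+ n) r _ = pascalAt n r

module Sums {c ℓ : Level} (R : CommutativeRing c ℓ) (q q⁻¹ : CommutativeRing.Carrier R)
            (q·q⁻¹≈1 : CommutativeRing._≈_ R (CommutativeRing._*_ R q q⁻¹) (CommutativeRing.1# R)) where
  open CommutativeRing R
  open Eval R q q⁻¹ using (qpow; β; sumR; _≈ᴿ_; _-ᴿ_; _*ᴿ_)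
  open Evaluation R q q⁻¹ q·q⁻¹≈1
  open Summation commutativeSemiring
  open import Data.List using (upTo)
  open import Relation.Binary.Reasoning.Setoid setoid
  open NaturalSolver commutativeSemiring (λ _ _ → nothing) using (solve; _:*_; _:=_)

  coefficient : (s l a P Q : ℤ) → ℕ → Carrier
  coefficient s l a P Q n =
    qpow (+ n ℤ.* (+ n ℤ.+ l ℤ.- (P ℤ.+ Q))) * gauss (s ℤ.- a) (P ℤ.- + n) * gauss a (Q ℤ.- + n)

  tailBinomial : (s l : ℤ) → ℕ → Carrier
  tailBinomial s l n = gauss (s ℤ.- l ℤ.+ + n) (+ n)

  B : (s l a P Q : ℤ) → ℕ → Carrier
  B s l a P Q K = Σ< (λ n → coefficient s l a P Q n * tailBinomial s l n) K

  coefficient-vanishes : ∀ s l a P Q n → P ℤ.< + n → coefficient s l a P Q n ≈ 0#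
  coefficient-vanishes s l a P Q n P<n =
    trans (*-congʳ (trans (*-congˡ (gauss-negative (s ℤ.- a) _ (negative-gap P n P<n))) (zeroʳ _))) (zeroˡ _)

  module _ {s l : ℤ} (l≤s : l ℤ.≤ s) where
    tail-nonneg : ∀ k → + 0 ℤ.≤ s ℤ.- l ℤ.+ + k
    tail-nonneg k = ℤP.+-mono-≤ (ℤP.i≤j⇒0≤j-i l≤s) (ℤ.+≤+ z≤n)

    tailBinomial-zero : tailBinomial (s ℤ.+ + 1) l 0 ≈ tailBinomial s l 0
    tailBinomial-zero = begin
      gauss ((s ℤ.+ + 1) ℤ.- l ℤ.+ + 0) (+ 0)
        ≈⟨ gauss-congˡ (+ 0) (tail-shift s l (+ 0)) ⟩
      gauss ((s ℤ.- l ℤ.+ + 0) ℤ.+ + 1) (+ 0)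
        ≈⟨ q-pascal (s ℤ.- l ℤ.+ + 0) (+ 0) (tail-nonneg 0) ⟩
      gauss (s ℤ.- l ℤ.+ + 0) (+ 0) + qpow ((s ℤ.- l ℤ.+ + 0) ℤ.+ + 1 ℤ.- + 0) * 0#
        ≈⟨ trans (+-congˡ (zeroʳ _)) (+-identityʳ _) ⟩
      gauss (s ℤ.- l ℤ.+ + 0) (+ 0) ∎

    tailBinomial-suc : ∀ n → tailBinomial (s ℤ.+ + 1) l (suc n)
                           ≈ tailBinomial s l (suc n) + qpow (s ℤ.- l ℤ.+ + 1) * tailBinomial (s ℤ.+ + 1) l n
    tailBinomial-suc n = begin
      gauss ((s ℤ.+ + 1) ℤ.- l ℤ.+ + suc n) (+ suc n)
        ≈⟨ gauss-congˡ (+ suc n) (tail-shift s l (+ suc n)) ⟩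
      gauss ((s ℤ.- l ℤ.+ + suc n) ℤ.+ + 1) (+ suc n)
        ≈⟨ q-pascal (s ℤ.- l ℤ.+ + suc n) (+ suc n) (tail-nonneg (suc n)) ⟩
      gauss (s ℤ.- l ℤ.+ + suc n) (+ suc n)
        + qpow ((s ℤ.- l ℤ.+ + suc n) ℤ.+ + 1 ℤ.- + suc n) * gauss (s ℤ.- l ℤ.+ + suc n) (+ suc n ℤ.- + 1)
        ≈⟨ +-congˡ (*-cong (qpow-cong (tail-gap s l (+ n))) (gauss-cong (tail-lower s l (+ n)) (pred-suc (+ n)))) ⟩
      gauss (s ℤ.- l ℤ.+ + suc n) (+ suc n) + qpow (s ℤ.- l ℤ.+ + 1) * gauss ((s ℤ.+ + 1) ℤ.- l ℤ.+ + n) (+ n) ∎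

  -- The coefficients satisfy the step relation needed for summation by
  -- parts: q-Pascal for [s+1-a ; P-n] and [a+1 ; Q-n], and matching powers.
  coefficient-step : ∀ s l a P Q → + 0 ℤ.≤ a → a ℤ.≤ s → ∀ n →
    coefficient s l a P Q n + qpow (s ℤ.- a ℤ.- P ℤ.+ + 1) * coefficient (s ℤ.+ + 1) l (a ℤ.+ + 1) (P ℤ.- + 1) Q n
      ≈ coefficient (s ℤ.+ + 1) l a P Q n + qpow (s ℤ.- l ℤ.+ + 1) * coefficient s l a P Q (suc n)
  coefficient-step s l a P Q 0≤a a≤s n =
    trans (+-congˡ (*-congˡ (*-congʳ (*-congˡ lowered))))
          (expand-pascal-pair upper-pascal lower-pascal powers₁ powers₂)
    where
    N = + n
    lowered : gauss ((s ℤ.+ + 1) ℤ.- (a ℤ.+ + 1)) ((P ℤ.- + 1) ℤ.- N) ≈ gauss (s ℤ.- a) (P ℤ.- + suc n)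
    lowered = gauss-cong (shift-both s a) (lower-first P N)
    upper-pascal : gauss ((s ℤ.+ + 1) ℤ.- a) (P ℤ.- N)
                   ≈ gauss (s ℤ.- a) (P ℤ.- N) + qpow ((s ℤ.- a) ℤ.+ + 1 ℤ.- (P ℤ.- N)) * gauss (s ℤ.- a) (P ℤ.- + suc n)
    upper-pascal = trans (gauss-congˡ (P ℤ.- N) (shift-complement s a))
      (trans (q-pascal (s ℤ.- a) (P ℤ.- N) (ℤP.i≤j⇒0≤j-i a≤s)) (+-congˡ (*-congˡ (gauss-congʳ (s ℤ.- a) (lower-gap P N)))))
    lower-pascal : gauss (a ℤ.+ + 1) (Q ℤ.- N)
                   ≈ gauss a (Q ℤ.- N) + qpow (a ℤ.+ + 1 ℤ.- (Q ℤ.- N)) * gauss a (Q ℤ.- + suc n)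
    lower-pascal = trans (q-pascal a (Q ℤ.- N) 0≤a) (+-congˡ (*-congˡ (gauss-congʳ a (lower-gap Q N))))
    c₀ = s ℤ.- a ℤ.- P ℤ.+ + 1
    u₂ = N ℤ.* (N ℤ.+ l ℤ.- ((P ℤ.- + 1) ℤ.+ Q))
    powers₁ : qpow c₀ * qpow u₂ ≈ qpow (N ℤ.* (N ℤ.+ l ℤ.- (P ℤ.+ Q))) * qpow ((s ℤ.- a) ℤ.+ + 1 ℤ.- (P ℤ.- N))
    powers₁ = qpow-balance c₀ u₂ (N ℤ.* (N ℤ.+ l ℤ.- (P ℤ.+ Q))) ((s ℤ.- a) ℤ.+ + 1 ℤ.- (P ℤ.- N))
                          (exponent-match₁ s a l P Q N)
    powers₂ : (qpow c₀ * qpow u₂) * qpow (a ℤ.+ + 1 ℤ.- (Q ℤ.- N))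
              ≈ qpow (s ℤ.- l ℤ.+ + 1) * qpow (+ suc n ℤ.* (+ suc n ℤ.+ l ℤ.- (P ℤ.+ Q)))
    powers₂ = trans (*-congʳ (sym (qpow-+ c₀ u₂))) (qpow-balance (c₀ ℤ.+ u₂) (a ℤ.+ + 1 ℤ.- (Q ℤ.- N))
                (s ℤ.- l ℤ.+ + 1) (+ suc n ℤ.* (+ suc n ℤ.+ l ℤ.- (P ℤ.+ Q))) (exponent-match₂ s a l P Q N))

  B-recurrence : ∀ s l a P Q K → l ℤ.≤ s → + 0 ℤ.≤ a → a ℤ.≤ s → P ℤ.< + K →
    B s l a P Q K + qpow (s ℤ.- a ℤ.- P ℤ.+ + 1) * B (s ℤ.+ + 1) l (a ℤ.+ + 1) (P ℤ.- + 1) Q K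
      ≈ B (s ℤ.+ + 1) l a P Q K
  B-recurrence s l a P Q K l≤s 0≤a a≤s P<K =
    summation-by-parts
      (coefficient s l a P Q) (coefficient (s ℤ.+ + 1) l a P Q) (coefficient (s ℤ.+ + 1) l (a ℤ.+ + 1) (P ℤ.- + 1) Q)
      (tailBinomial s l) (tailBinomial (s ℤ.+ + 1) l) (qpow (s ℤ.- l ℤ.+ + 1)) (qpow (s ℤ.- a ℤ.- P ℤ.+ + 1))
      (tailBinomial-zero l≤s) (tailBinomial-suc l≤s) (coefficient-step s l a P Q 0≤a a≤s)
      K (coefficient-vanishes s l a P Q K P<K)

  B-swap : ∀ s l a a' P Q K → a ℤ.+ a' ≡ s → B s l a P Q K ≈ B s l a' Q P K
  B-swap s l a a' P Q K ≡.refl = Σ<-cong K λ n → *-congʳ (swap-term n)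
    where
    swap-term : ∀ n → coefficient (a ℤ.+ a') l a P Q n ≈ coefficient (a ℤ.+ a') l a' Q P n
    swap-term n = begin
      qpow (N ℤ.* (N ℤ.+ l ℤ.- (P ℤ.+ Q))) * gauss ((a ℤ.+ a') ℤ.- a) (P ℤ.- N) * gauss a (Q ℤ.- N)
        ≈⟨ *-cong (*-cong (qpow-cong (≡.cong (λ t → N ℤ.* (N ℤ.+ l ℤ.- t)) (ℤP.+-comm P Q)))
                          (gauss-congˡ (P ℤ.- N) (complement-left a a')))
                  (gauss-congˡ (Q ℤ.- N) (≡.sym (complement-right a a'))) ⟩
      qpow (N ℤ.* (N ℤ.+ l ℤ.- (Q ℤ.+ P))) * gauss a' (P ℤ.- N) * gauss ((a ℤ.+ a') ℤ.- a') (Q ℤ.- N)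
        ≈⟨ solve 3 (λ u x y → u :* x :* y := u :* y :* x) refl _ _ _ ⟩
      qpow (N ℤ.* (N ℤ.+ l ℤ.- (Q ℤ.+ P))) * gauss ((a ℤ.+ a') ℤ.- a') (Q ℤ.- N) * gauss a' (P ℤ.- N) ∎
      where N = + n

  -- Second recurrence, the first one reflected by a ↦ s + 1 - a:
  -- B(s,a-1;P,Q) + q^{a-Q} B(s+1,a-1;P,Q-1) = B(s+1,a;P,Q).
  B-recurrence-reflected : ∀ s l a P Q K → l ℤ.≤ s → + 0 ℤ.< a → a ℤ.≤ s → Q ℤ.< + K →
    B s l (a ℤ.- + 1) P Q K + qpow (a ℤ.- Q) * B (s ℤ.+ + 1) l (a ℤ.- + 1) P (Q ℤ.- + 1) K
      ≈ B (s ℤ.+ + 1) l a P Q K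
  B-recurrence-reflected s l a P Q K l≤s 0<a a≤s Q<K = begin
    B s l (a ℤ.- + 1) P Q K + qpow (a ℤ.- Q) * B (s ℤ.+ + 1) l (a ℤ.- + 1) P (Q ℤ.- + 1) K
      ≈⟨ +-cong (B-swap s l _ a' P Q K (reflect₁ s a))
                (*-cong (qpow-cong (reflect-exponent s a Q)) (B-swap (s ℤ.+ + 1) l _ (a' ℤ.+ + 1) P _ K (reflect₂ s a))) ⟩
    B s l a' Q P K + qpow (s ℤ.- a' ℤ.- Q ℤ.+ + 1) * B (s ℤ.+ + 1) l (a' ℤ.+ + 1) (Q ℤ.- + 1) P K
      ≈⟨ B-recurrence s l a' Q P K l≤s (reflect-nonneg a≤s) (reflect-≤ 0<a) Q<K ⟩
    B (s ℤ.+ + 1) l a' Q P K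
      ≈⟨ B-swap (s ℤ.+ + 1) l a' a Q P K (reflect₃ s a) ⟩
    B (s ℤ.+ + 1) l a P Q K ∎
    where a' = (s ℤ.+ + 1) ℤ.- a

  βterm : (m s l a b : ℤ) → ℕ → Carrier
  βterm m s l a b n' =
    let n = + n' in
    qpow (n ℤ.* (((n ℤ.- (+ ∣ b ∣)) ℤ.+ l) ℤ.- ((+ 2) ℤ.* m)))
      * gauss (s ℤ.- a) ((b ₊) ℤ.+ m ℤ.- n)
      * gauss a ((b ₋) ℤ.+ m ℤ.- n)
      * gauss (s ℤ.- l ℤ.+ n) n

  β-unfold : ∀ m s l a b k → + ∣ b ∣ ℤ.+ m ≡ + k → β m s l a b ≈ sumR (map (βterm m s l a b) (upTo (suc k)))
  β-unfold m s l a b k e with + ∣ b ∣ ℤ.+ m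
  β-unfold m s l a b k ≡.refl | .(+ k) = refl

  β-empty : ∀ m s l a b k → + ∣ b ∣ ℤ.+ m ≡ -[1+ k ] → β m s l a b ≈ 0#
  β-empty m s l a b k e with + ∣ b ∣ ℤ.+ m
  β-empty m s l a b k ≡.refl | .(-[1+ k ]) = refl

  βterm-as-B : ∀ m s l a b n → βterm m s l a b n ≈ coefficient s l a (b ₊ ℤ.+ m) (b ₋ ℤ.+ m) n * tailBinomial s l n
  βterm-as-B m s l a b n = *-congʳ (*-congʳ (*-congʳ (qpow-cong exponent)))
    where
    exponent : + n ℤ.* (((+ n ℤ.- + ∣ b ∣) ℤ.+ l) ℤ.- (+ 2 ℤ.* m)) ≡ + n ℤ.* (+ n ℤ.+ l ℤ.- ((b ₊ ℤ.+ m) ℤ.+ (b ₋ ℤ.+ m)))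
    exponent = ≡.trans (≡.cong (λ t → + n ℤ.* (((+ n ℤ.- t) ℤ.+ l) ℤ.- (+ 2 ℤ.* m))) (abs-split b))
                       (β-exponent (+ n) (b ₊) (b ₋) l m)

  β-as-B : ∀ m s l a b P Q K → b ₊ ℤ.+ m ≡ P → b ₋ ℤ.+ m ≡ Q → P ℤ.< + K → Q ℤ.< + K →
    β m s l a b ≈ B s l a P Q K
  β-as-B m s l a b _ _ K ≡.refl ≡.refl P<K Q<K = by-range (+ ∣ b ∣ ℤ.+ m) ≡.refl
    where
    f = λ n → coefficient s l a (b ₊ ℤ.+ m) (b ₋ ℤ.+ m) n * tailBinomial s l n
    beyond : ∀ n → + ∣ b ∣ ℤ.+ m ℤ.< + n → f n ≈ 0#
    beyond n h = trans (*-congʳ (coefficient-vanishes s l a _ _ n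
                   (ℤP.≤-<-trans (ℤP.+-monoˡ-≤ m (₊≤abs b)) h))) (zeroˡ _)
    by-range : ∀ v → + ∣ b ∣ ℤ.+ m ≡ v → β m s l a b ≈ B s l a (b ₊ ℤ.+ m) (b ₋ ℤ.+ m) K
    by-range (+ k) e = begin
      β m s l a b                                  ≈⟨ β-unfold m s l a b k e ⟩
      sumR (map (βterm m s l a b) (upTo (suc k)))  ≈⟨ reflexive (≡.cong (foldr _+_ 0#) (ListP.map-upTo _ (suc k))) ⟩
      foldr _+_ 0# (applyUpTo (βterm m s l a b) (suc k)) ≈⟨ foldr-applyUpTo _ (suc k) ⟩
      Σ< (βterm m s l a b) (suc k)                ≈⟨ Σ<-cong (suc k) (βterm-as-B m s l a b) ⟩
      Σ< f (suc k)                                 ≈⟨ sym (Σ<-extend f (suc k) K k<K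
                                                         (λ n k<n → beyond n (≡.subst (ℤ._< + n) (≡.sym e) (ℤ.+<+ k<n)))) ⟩
      Σ< f K ∎
      where
      k<K : suc k ℕ.≤ K
      k<K = ℤP.drop‿+<+ (≡.subst (ℤ._< + K) e (abs-bound b m (+ K) P<K Q<K))
    by-range -[1+ k ] e = trans (β-empty m s l a b k e)
      (sym (Σ<-extend f 0 K z≤n (λ n _ → beyond n (≡.subst (ℤ._< + n) (≡.sym e) ℤ.-<+))))

  transport : ∀ {x y z X Y Z : Carrier} {e e' : ℤ} → x ≈ X → y ≈ Y → z ≈ Z → e ≡ e' →
    X + qpow e' * Z ≈ Y → x ≈ᴿ y -ᴿ qpow e *ᴿ z
  transport {x} {y} {z} {X} {Y} {Z} {e} {e'} x≈X y≈Y z≈Z e≡e' recurrence = begin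
    x                                 ≈⟨ x≈X ⟩
    X                                 ≈⟨ sym (+-identityʳ X) ⟩
    X + 0#                            ≈⟨ +-congˡ (sym (-‿inverseʳ (qpow e' * Z))) ⟩
    X + (qpow e' * Z + - (qpow e' * Z)) ≈⟨ sym (+-assoc _ _ _) ⟩
    (X + qpow e' * Z) + - (qpow e' * Z) ≈⟨ +-cong recurrence (-‿cong (*-cong (qpow-cong (≡.sym e≡e')) (sym z≈Z))) ⟩
    Y + - (qpow e * z)                ≈⟨ +-congʳ (sym y≈Y) ⟩
    y + - (qpow e * z)                ∎

-- The four recurrences for β.  Each is a recurrence for B read back through
-- β = B(s,a;b₊+m,b₋+m), with the summation range K large enough for all
-- three sums involved.

module Recurrences {c ℓ : Level} (R : CommutativeRing c ℓ) (q q⁻¹ : CommutativeRing.Carrier R)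
                   (q·q⁻¹≈1 : CommutativeRing._≈_ R (CommutativeRing._*_ R q q⁻¹) (CommutativeRing.1# R))
                   (s l a b m : ℤ) (l≤s : l ℤ.≤ s) where
  open CommutativeRing R using (_≈_)
  open Eval R q q⁻¹
  open Sums R q q⁻¹ q·q⁻¹≈1
  open import Data.Integer using (_+_; _-_)

  range : ℤ → ℤ → ℕ
  range P Q = suc (∣ P ∣ ℕ.+ ∣ Q ∣)

  left-in-range : ∀ P Q → P ℤ.< + range P Q
  left-in-range P Q = below-suc P _ (ℕP.m≤m+n ∣ P ∣ ∣ Q ∣)

  right-in-range : ∀ P Q → Q ℤ.< + range P Q
  right-in-range P Q = below-suc Q _ (ℕP.m≤n+m ∣ Q ∣ ∣ P ∣)

  P = b ₊ + m
  Q = b ₋ + m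
  K = range P Q
  P<K = left-in-range P Q
  Q<K = right-in-range P Q

  β-at : ∀ s' a' → β m s' l a' b ≈ B s' l a' P Q K
  β-at s' a' = β-as-B m s' l a' b P Q K ≡.refl ≡.refl P<K Q<K

  -- (i), b > 0: first recurrence; b - 1 lowers b₊ and keeps b₋ = 0
  recurrence-i : + 0 ℤ.≤ a → a ℤ.≤ s → b ℤ.> + 0 →
    β m s l a b ≈ᴿ β m (s + + 1) l a b -ᴿ qpow (s - a - b - m + + 1) *ᴿ β m (s + + 1) l (a + + 1) (b - + 1)
  recurrence-i 0≤a a≤s b>0 with lowering-positive s a b m b>0
  ... | new-P , new-Q , exponent =
    transport (β-at s a) (β-at (s + + 1) a)
              (β-as-B m (s + + 1) l (a + + 1) (b - + 1) (P - + 1) Q K new-P new-Q (pred-< P<K) Q<K)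
              exponent (B-recurrence s l a P Q K l≤s 0≤a a≤s P<K)

  -- (ii), b ≥ 0: second recurrence; b + 1 and m - 1 keep b₊ + m and lower b₋ + m
  recurrence-ii : a ℤ.> + 0 → a ℤ.≤ s → + 0 ℤ.≤ b →
    β m s l (a - + 1) b ≈ᴿ β m (s + + 1) l a b -ᴿ qpow (a - m) *ᴿ β (m - + 1) (s + + 1) l (a - + 1) (b + + 1)
  recurrence-ii a>0 a≤s 0≤b with raising-nonnegative a b m 0≤b
  ... | new-P , new-Q , exponent =
    transport (β-at s (a - + 1)) (β-at (s + + 1) a)
              (β-as-B (m - + 1) (s + + 1) l (a - + 1) (b + + 1) P (Q - + 1) K new-P new-Q P<K (pred-< Q<K))
              exponent (B-recurrence-reflected s l a P Q K l≤s a>0 a≤s Q<K)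

  -- (iii), b ≤ 0: first recurrence; b - 1 and m - 1 lower b₊ + m and keep b₋ + m
  recurrence-iii : + 0 ℤ.≤ a → a ℤ.≤ s → b ℤ.≤ + 0 →
    β m s l a b ≈ᴿ β m (s + + 1) l a b -ᴿ qpow (s - a - m + + 1) *ᴿ β (m - + 1) (s + + 1) l (a + + 1) (b - + 1)
  recurrence-iii 0≤a a≤s b≤0 with lowering-nonpositive s a b m b≤0
  ... | new-P , new-Q , exponent =
    transport (β-at s a) (β-at (s + + 1) a)
              (β-as-B (m - + 1) (s + + 1) l (a + + 1) (b - + 1) (P - + 1) Q K new-P new-Q (pred-< P<K) Q<K)
              exponent (B-recurrence s l a P Q K l≤s 0≤a a≤s P<K)

  -- (iv), b < 0: second recurrence; b + 1 keeps b₊ = 0 and lowers b₋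
  recurrence-iv : a ℤ.> + 0 → a ℤ.≤ s → b ℤ.< + 0 →
    β m s l (a - + 1) b ≈ᴿ β m (s + + 1) l a b -ᴿ qpow (a + b - m) *ᴿ β m (s + + 1) l (a - + 1) (b + + 1)
  recurrence-iv a>0 a≤s b<0 with raising-negative a b m b<0
  ... | new-P , new-Q , exponent =
    transport (β-at s (a - + 1)) (β-at (s + + 1) a)
              (β-as-B m (s + + 1) l (a - + 1) (b + + 1) P (Q - + 1) K new-P new-Q P<K (pred-< Q<K))
              exponent (B-recurrence-reflected s l a P Q K l≤s a>0 a≤s Q<K)

open import Data.Integer using (_≤_; _<_; _>_; _+_; _-_)

proposition3p1 : ∀ {c ℓ} (R : CommutativeRing c ℓ) (q q⁻¹ : CommutativeRing.Carrier R) →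
    CommutativeRing._≈_ R (CommutativeRing._*_ R q q⁻¹) (CommutativeRing.1# R) →
    let open Eval R q q⁻¹ in
    (s l a b m : ℤ) → l ≤ s → + 0 ≤ a → a ≤ s →
      (b > + 0 →
        β m s l a b ≈ᴿ β m (s + + 1) l a b -ᴿ qpow (s - a - b - m + + 1) *ᴿ β m (s + + 1) l (a + + 1) (b - + 1))
    × (a > + 0 → + 0 ≤ b →
        β m s l (a - + 1) b ≈ᴿ β m (s + + 1) l a b -ᴿ qpow (a - m) *ᴿ β (m - + 1) (s + + 1) l (a - + 1) (b + + 1))
    × (b ≤ + 0 →
        β m s l a b ≈ᴿ β m (s + + 1) l a b -ᴿ qpow (s - a - m + + 1) *ᴿ β (m - + 1) (s + + 1) l (a + + 1) (b - + 1))
    × (a > + 0 → b < + 0 →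
        β m s l (a - + 1) b ≈ᴿ β m (s + + 1) l a b -ᴿ qpow (a + b - m) *ᴿ β m (s + + 1) l (a - + 1) (b + + 1))
proposition3p1 R q q⁻¹ q·q⁻¹≈1 s l a b m l≤s 0≤a a≤s =
    recurrence-i 0≤a a≤s
  , (λ a>0 → recurrence-ii a>0 a≤s)
  , recurrence-iii 0≤a a≤s
  , (λ a>0 → recurrence-iv a>0 a≤s)
  where open Recurrences R q q⁻¹ q·q⁻¹≈1 s l a b m l≤s
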